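{- Let $p>3$ be a prime. Then the following polynomial congruence holds in $\mathbb{Z}_{(p)}[t]$: \[ p\sum_{k=1}^{p-1} \frac{t^k}{k^3\binom{2k}{k}} \equiv \frac{1-\bigl(v_p(2-t)+t^p\bigr)\binom{2p}{p}^{ -1}}{p^2}-\frac{1}{p}\sum_{k=1}^{p-1} \frac{v_{k}(2-t)}{k} \pmod{p^2}. \]
   Context: The Lucas polynomials $v_n(x)\in\mathbb{Z}[x]$ are defined by $v_0=2$, $v_1=x$, $v_n(x)=x\,v_{n-1}(x)-v_{n-2}(x)$ for $n>1$. $\mathbb{Z}_{(p)}$ denotes the rationals whose denominators are prime to $p$; for polynomials $A,B\in\mathbb{Q}[t]$, $A\equiv B\pmod{p^m}$ means that $A-B\in p^m\mathbb{Z}_{(p)}[t]$. -}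

module Defs where

open import Data.Nat as ℕ using (ℕ; zero; suc; _∸_; _≤_; _≤?_)
open import Data.Nat.Combinatorics using (_C_)
open import Data.Integer as ℤ using (ℤ; +_)
open import Data.Nat.Divisibility using (_∣_)
open import Data.Rational as ℚ using (ℚ; 0ℚ; 1ℚ; _+_; _*_; _-_; -_; 1/_; ≢-nonZero)
open import Data.Rational.Properties using (_≟_)
open import Data.Product using (Σ; _×_)
open import Relation.Nullary using (¬_; yes; no)
open import Relation.Binary.PropositionalEquality using (_≡_)
open import Data.Bool using (if_then_else_)
open import Relation.Nullary.Decidable using (⌊_⌋; _×-dec_)

-- Total multiplicative inverse on ℚ (inv 0 = 0; only applied to nonzero values below).
inv : ℚ → ℚ
inv q with q ≟ 0ℚ
... | yes _ = 0ℚ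
... | no q≢0 = 1/_ q {{≢-nonZero q≢0}}

nq : ℕ → ℚ
nq n = + n ℚ./ 1

sumℚ : ℕ → (ℕ → ℚ) → ℚ
sumℚ zero f = 0ℚ
sumℚ (suc n) f = sumℚ n f + f (suc n)

-- Polynomials in ℚ[t], represented by their coefficient sequences (coefficient of t^i).
Poly : Set
Poly = ℕ → ℚ

const : ℚ → Poly
const c zero = c
const c (suc i) = 0ℚ

monomial : ℕ → Poly
monomial n i = if ⌊ n ℕ.≟ i ⌋ then 1ℚ else 0ℚ

_⊕_ : Poly → Poly → Poly
(f ⊕ g) i = f i + g i

_⊖_ : Poly → Poly → Poly
(f ⊖ g) i = f i - g i

_·_ : ℚ → Poly → Poly
(c · f) i = c * f i

-- Cauchy product: (f ⊛ g)_i = Σ_{j=0}^{i} f_j g_{i-j}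
_⊛_ : Poly → Poly → Poly
(f ⊛ g) i = sumℚ (suc i) (λ j → f (j ∸ 1) * g (i ∸ (j ∸ 1)))

sumP : ℕ → (ℕ → Poly) → Poly
sumP zero F = const 0ℚ
sumP (suc n) F = sumP n F ⊕ F (suc n)

lucas : Poly → ℕ → Poly
lucas x zero = const (nq 2)
lucas x (suc zero) = x
lucas x (suc (suc n)) = (x ⊛ lucas x (suc n)) ⊖ lucas x n

twoMinusT : Poly
twoMinusT = const (nq 2) ⊖ monomial 1

InPowZp : ℕ → ℕ → ℚ → Set
InPowZp p m q = Σ ℚ (λ r → (q ≡ nq (p ℕ.^ m) * r) × ¬ (p ∣ ℚ.denominatorℕ r))

_≡_[modP_^_] : Poly → Poly → ℕ → ℕ → Set
A ≡ B [modP p ^ m ] = (i : ℕ) → InPowZp p m (A i - B i)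

lhs : ℕ → Poly
lhs p = sumP (p ∸ 1) (λ k → (nq p * inv (nq (k ℕ.^ 3) * nq ((2 ℕ.* k) C k))) · monomial k)

rhs : ℕ → Poly
rhs p = (inv (nq (p ℕ.^ 2)) · (const 1ℚ ⊖ (inv (nq ((2 ℕ.* p) C p)) · (lucas twoMinusT p ⊕ monomial p))))
        ⊖ (inv (nq p) · sumP (p ∸ 1) (λ k → inv (nq k) · lucas twoMinusT k))

module Submission where

-- The proof compares the coefficients of t^i, writing p = 2h + 1.
-- * [t^i] v_k(2-t) = (-1)^i (C(k+i,2i) + C(k+i-1,2i)); this vanishes for i > k, and by absorption
--   and the hockey-stick identity Σ_{k<p} [t^i] v_k(2-t)/k = (-1)^i C(p+i-1,2i)/i.
-- * i = 0: the left side is 0, and the right side only involves H_{p-1} = pT and C(2p,p) = 2Q,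
--   where T ≡ 0 (mod p) and Q ≡ 1 + 2p²T (mod p⁴) (Wolstenholme; the only use of p > 3).
-- * 1 ≤ i ≤ p-1: by (-1)^(i-1) C(p+i-1,2i-1) (2i-1)! = p Π_{t<i} (t² - p²) ≡ p ((i-1)!)² (mod p³)
--   and C(2p,p) ≡ 2 (mod p³), the difference is p/(2i-1)! times an element of p² ℤ_(p).
-- * i ≥ p: only t^p survives on the right, where v_p(2-t) contributes (-1)^p t^p = -t^p.
-- The file develops binomial identities, arithmetic in ℚ, finite sums and products, the local
-- ring ℤ_(p) and its ideals p^m ℤ_(p), coefficient extraction, the Wolstenholme congruences,
-- and finally the coefficientwise congruence, from which theorem6p2 follows.

open import Defs
open import Data.Nat using (ℕ; _<_; suc)
import Data.Nat as ℕ
open import Data.Nat.Primality using (Prime)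
open import Data.Rational using (ℚ)
open import Data.Product using (_,_)
open import Relation.Binary.PropositionalEquality using (_≡_; refl)

module Binomial where

  open import Data.Nat
  open import Data.Nat.Properties
  open import Relation.Binary.PropositionalEquality
  open import Data.Nat.Combinatorics using (_C_; nCk+nC[k+1]≡[n+1]C[k+1]; k>n⇒nCk≡0)
  open import Data.Nat.Tactic.RingSolver using (solve-∀)
  open ≡-Reasoning

  -- Binomial coefficients defined by Pascal's rule, so that they compute
  -- by pattern matching; `binom≡C` identifies them with the library's.
  binom : ℕ → ℕ → ℕ
  binom n zero = 1
  binom zero (suc k) = 0
  binom (suc n) (suc k) = binom n k + binom n (suc k)

  binom≡C : ∀ n k → binom n k ≡ n C k
  binom≡C n zero = refl
  binom≡C zero (suc k) = sym (k>n⇒nCk≡0 {0} {suc k} (s≤s z≤n))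
  binom≡C (suc n) (suc k) =
    trans (cong₂ _+_ (binom≡C n k) (binom≡C n (suc k))) (nCk+nC[k+1]≡[n+1]C[k+1] n k)

  binom-vanish : ∀ n k → n < k → binom n k ≡ 0
  binom-vanish zero (suc k) _ = refl
  binom-vanish (suc n) (suc k) (s≤s n<k) =
    cong₂ _+_ (binom-vanish n k n<k) (binom-vanish n (suc k) (m<n⇒m<1+n n<k))

  binom-diag : ∀ n → binom n n ≡ 1
  binom-diag zero = refl
  binom-diag (suc n) = cong₂ _+_ (binom-diag n) (binom-vanish n (suc n) (n<1+n n))

  binom-one : ∀ n → binom n 1 ≡ n
  binom-one zero = refl
  binom-one (suc n) = cong suc (binom-one n)

  binom-absorb : ∀ n k → suc k * binom (suc n) (suc k) ≡ suc n * binom n k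
  binom-absorb zero zero = refl
  binom-absorb zero (suc k) = *-zeroʳ (suc (suc k))
  binom-absorb (suc n) zero = cong suc (trans (+-identityʳ _) (trans (binom-one (suc n)) (sym (*-identityʳ (suc n)))))
  binom-absorb (suc n) (suc k) = begin
    suc (suc k) * (b + b′)                 ≡⟨ *-distribˡ-+ (suc (suc k)) b b′ ⟩
    (b + suc k * b) + suc (suc k) * b′     ≡⟨ cong₂ _+_ (cong (b +_) (binom-absorb n k)) (binom-absorb n (suc k)) ⟩
    (b + suc n * binom n k) + suc n * binom n (suc k) ≡⟨ regroup b n (binom n k) (binom n (suc k)) ⟩
    b + suc n * (binom n k + binom n (suc k)) ∎
    where
    b = binom (suc n) (suc k)
    b′ = binom (suc n) (suc (suc k))
    regroup : ∀ a n x y → (a + suc n * x) + suc n * y ≡ a + suc n * (x + y)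
    regroup = solve-∀

  binom-absorb-pascal : ∀ m k → suc k * binom m (suc k) + suc k * binom m k ≡ suc m * binom m k
  binom-absorb-pascal m k = begin
    suc k * binom m (suc k) + suc k * binom m k ≡⟨ +-comm (suc k * binom m (suc k)) _ ⟩
    suc k * binom m k + suc k * binom m (suc k) ≡⟨ *-distribˡ-+ (suc k) (binom m k) _ ⟨
    suc k * binom (suc m) (suc k)               ≡⟨ binom-absorb m k ⟩
    suc m * binom m k ∎

  binom-second-difference : ∀ n r →
    binom (2 + n) (2 + r) + binom n (2 + r) ≡ 2 * binom (1 + n) (2 + r) + binom n r
  binom-second-difference n r = regroup (binom n r) (binom n (1 + r)) (binom n (2 + r))
    where
    regroup : ∀ a b c → ((a + b) + (b + c)) + c ≡ 2 * (b + c) + a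
    regroup = solve-∀

  sumℕ : ℕ → (ℕ → ℕ) → ℕ
  sumℕ zero f = 0
  sumℕ (suc n) f = sumℕ n f + f (suc n)

  hockey-stick : ∀ n j r → j < r → sumℕ n (λ k → binom (k + j) r) ≡ binom (suc (n + j)) (suc r)
  hockey-stick zero j r j<r = sym (binom-vanish (suc j) (suc r) (s≤s j<r))
  hockey-stick (suc n) j r j<r =
    trans (cong (_+ binom (suc (n + j)) r) (hockey-stick n j r j<r)) (+-comm (binom (suc (n + j)) (suc r)) (binom (suc (n + j)) r))

  rising : ℕ → ℕ → ℕ
  rising a zero = 1
  rising a (suc k) = rising a k * (a + suc k)

  binom-rising : ∀ a k → binom (a + k) k * k ! ≡ rising a k
  binom-rising a zero = refl
  binom-rising a (suc k) = begin
    binom (a + suc k) (suc k) * (suc k * k !)   ≡⟨ cong (λ z → binom z (suc k) * (suc k * k !)) (+-suc a k) ⟩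
    binom (suc (a + k)) (suc k) * (suc k * k !) ≡⟨ shuffle (binom (suc (a + k)) (suc k)) (suc k) (k !) ⟩
    (suc k * binom (suc (a + k)) (suc k)) * k ! ≡⟨ cong (_* k !) (binom-absorb (a + k) k) ⟩
    (suc (a + k) * binom (a + k) k) * k !       ≡⟨ *-assoc (suc (a + k)) (binom (a + k) k) (k !) ⟩
    suc (a + k) * (binom (a + k) k * k !)       ≡⟨ cong (suc (a + k) *_) (binom-rising a k) ⟩
    suc (a + k) * rising a k                    ≡⟨ *-comm (suc (a + k)) (rising a k) ⟩
    rising a k * suc (a + k)                    ≡⟨ cong (rising a k *_) (+-suc a k) ⟨
    rising a k * (a + suc k) ∎
    where
    shuffle : ∀ x y z → x * (y * z) ≡ (y * x) * z
    shuffle = solve-∀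

  factorial-rising : ∀ a k → a ! * rising a k ≡ (a + k) !
  factorial-rising a zero = trans (*-identityʳ _) (cong _! (sym (+-identityʳ a)))
  factorial-rising a (suc k) = begin
    a ! * (rising a k * (a + suc k)) ≡⟨ *-assoc (a !) (rising a k) _ ⟨
    (a ! * rising a k) * (a + suc k) ≡⟨ cong₂ _*_ (factorial-rising a k) (+-suc a k) ⟩
    (a + k) ! * suc (a + k)          ≡⟨ *-comm ((a + k) !) _ ⟩
    suc (a + k) !                    ≡⟨ cong _! (+-suc a k) ⟨
    (a + suc k) ! ∎

  factorial≢0 : ∀ n → n ! ≢ 0
  factorial≢0 n = ≢-nonZero⁻¹ (n !) {{n !≢0}}

  central-binomial : ∀ m → binom (m + m) m * (m ! * m !) ≡ (m + m) !
  central-binomial m = begin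
    b * (f * f) ≡⟨ *-assoc b f f ⟨
    (b * f) * f ≡⟨ *-comm (b * f) f ⟩
    f * (b * f) ≡⟨ cong (f *_) (binom-rising m m) ⟩
    f * rising m m ≡⟨ factorial-rising m m ⟩
    (m + m) ! ∎
    where
    b = binom (m + m) m
    f = m !

  -- The coefficient of t^i in v_k(2-t) is (-1)^i lucasNum k i, where
  -- lucasNum k i = C(k+i,2i) + C(k+i-1,2i); the two summands are
  -- lucasHalf 0 and lucasHalf 1.
  lucasHalf : ℕ → ℕ → ℕ → ℕ
  lucasHalf c k i = binom (k + i ∸ c) (i + i)

  lucasNum : ℕ → ℕ → ℕ
  lucasNum k i = lucasHalf 0 k i + lucasHalf 1 k i

  double-suc : ∀ j → suc j + suc j ≡ 2 + (j + j)
  double-suc j = cong suc (+-suc j j)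

  -- Each half satisfies the recurrence inherited from v_{k+2} = (2-t) v_{k+1} - v_k.
  lucasHalf-rec : ∀ c k j → c ≤ 1 →
    lucasHalf c (2 + k) (1 + j) + lucasHalf c k (1 + j) ≡ 2 * lucasHalf c (1 + k) (1 + j) + lucasHalf c (1 + k) j
  lucasHalf-rec c k j c≤1 = begin
    binom (2 + k + (1 + j) ∸ c) (1 + j + (1 + j)) + binom (k + (1 + j) ∸ c) (1 + j + (1 + j))
      ≡⟨ cong₂ _+_ (cong₂ binom top (double-suc j)) (cong₂ binom bottom (double-suc j)) ⟩
    binom (2 + n) (2 + (j + j)) + binom n (2 + (j + j))
      ≡⟨ binom-second-difference n (j + j) ⟩
    2 * binom (1 + n) (2 + (j + j)) + binom n (j + j)
      ≡⟨ cong (λ z → 2 * z + binom n (j + j)) (cong₂ binom (sym middle) (sym (double-suc j))) ⟩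
    2 * binom (1 + k + (1 + j) ∸ c) (1 + j + (1 + j)) + binom n (j + j) ∎
    where
    n = suc (k + j) ∸ c
    c≤ : ∀ m → c ≤ suc m
    c≤ m = ≤-trans c≤1 (s≤s z≤n)
    bottom : k + (1 + j) ∸ c ≡ n
    bottom = cong (_∸ c) (+-suc k j)
    middle : 1 + k + (1 + j) ∸ c ≡ 1 + n
    middle = trans (cong (_∸ c) (cong suc (+-suc k j))) (+-∸-assoc 1 (c≤ (k + j)))
    top : 2 + k + (1 + j) ∸ c ≡ 2 + n
    top = trans (cong (_∸ c) (cong (2 +_) (+-suc k j))) (+-∸-assoc 2 (c≤ (k + j)))

  lucasNum-rec : ∀ k j →
    lucasNum (2 + k) (1 + j) + lucasNum k (1 + j) ≡ 2 * lucasNum (1 + k) (1 + j) + lucasNum (1 + k) j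
  lucasNum-rec k j = begin
    (a₂ + b₂) + (a₀ + b₀) ≡⟨ swap-middle a₂ b₂ a₀ b₀ ⟩
    (a₂ + a₀) + (b₂ + b₀) ≡⟨ cong₂ _+_ (lucasHalf-rec 0 k j z≤n) (lucasHalf-rec 1 k j ≤-refl) ⟩
    (2 * a₁ + a₁′) + (2 * b₁ + b₁′) ≡⟨ collect a₁ a₁′ b₁ b₁′ ⟩
    2 * (a₁ + b₁) + (a₁′ + b₁′) ∎
    where
    a₂ = lucasHalf 0 (2 + k) (1 + j)
    b₂ = lucasHalf 1 (2 + k) (1 + j)
    a₀ = lucasHalf 0 k (1 + j)
    b₀ = lucasHalf 1 k (1 + j)
    a₁ = lucasHalf 0 (1 + k) (1 + j)
    b₁ = lucasHalf 1 (1 + k) (1 + j)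
    a₁′ = lucasHalf 0 (1 + k) j
    b₁′ = lucasHalf 1 (1 + k) j
    swap-middle : ∀ a b c d → (a + b) + (c + d) ≡ (a + c) + (b + d)
    swap-middle = solve-∀
    collect : ∀ a b c d → (2 * a + b) + (2 * c + d) ≡ 2 * (a + c) + (b + d)
    collect = solve-∀

  lucasNum-vanish : ∀ k i → k < i → lucasNum k i ≡ 0
  lucasNum-vanish k i k<i = cong₂ _+_ (binom-vanish (k + i) (i + i) k+i<i+i)
    (binom-vanish (k + i ∸ 1) (i + i) (≤-<-trans (m∸n≤m (k + i) 1) k+i<i+i))
    where
    k+i<i+i : k + i < i + i
    k+i<i+i = +-monoˡ-< i k<i

  lucasNum-diag : ∀ n → lucasNum (suc n) (suc n) ≡ 1
  lucasNum-diag n = cong₂ _+_ (binom-diag (suc n + suc n))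
    (binom-vanish (n + suc n) (suc n + suc n) (n<1+n (n + suc n)))

  lucasNum-absorb : ∀ k j → suc j * lucasNum k (suc j) ≡ k * binom (k + j) (suc (j + j))
  lucasNum-absorb k j = +-cancelʳ-≡ (suc j * A) (suc j * lucasNum k (suc j)) (k * A) (begin
    suc j * lucasNum k (suc j) + suc j * A  ≡⟨ cong (λ z → suc j * z + suc j * A) halves ⟩
    suc j * ((A + B) + B) + suc j * A      ≡⟨ double-out j A B ⟩
    suc (suc (j + j)) * B + suc (suc (j + j)) * A ≡⟨ binom-absorb-pascal (k + j) (suc (j + j)) ⟩
    suc (k + j) * A                        ≡⟨ split k j A ⟩
    k * A + suc j * A ∎)
    where
    A = binom (k + j) (suc (j + j))
    B = binom (k + j) (suc (suc (j + j)))
    halves : lucasNum k (suc j) ≡ (A + B) + B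
    halves = cong₂ _+_ (cong₂ binom (+-suc k j) (double-suc j)) (cong₂ binom (cong (_∸ 1) (+-suc k j)) (double-suc j))
    double-out : ∀ j a b → suc j * ((a + b) + b) + suc j * a ≡ suc (suc (j + j)) * b + suc (suc (j + j)) * a
    double-out = solve-∀
    split : ∀ k j a → suc (k + j) * a ≡ k * a + suc j * a
    split = solve-∀

module RationalArithmetic where

  open import Data.Nat as ℕ using (ℕ)
  import Data.Nat.Properties as ℕP
  open import Data.Integer as ℤ using (ℤ; +_)
  import Data.Integer.Properties as ℤP
  import Data.Integer.Tactic.RingSolver as ℤ-Solver
  open import Data.Rational as ℚ using (ℚ; 0ℚ; 1ℚ; _+_; _*_; _-_; -_; _/_; toℚᵘ; ≢-nonZero)
  open import Data.Rational.Properties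
  import Data.Rational.Unnormalised as ℚᵘ
  import Data.Rational.Unnormalised.Properties as ℚᵘP
  open import Relation.Binary.PropositionalEquality
  open import Relation.Nullary using (yes; no; Dec)
  open import Relation.Nullary.Decidable using (dec⇒maybe)
  open import Data.Empty using (⊥-elim)
  open import Tactic.RingSolver using (solve-∀)
  open import Tactic.RingSolver.Core.AlmostCommutativeRing using (AlmostCommutativeRing; fromCommutativeRing)
  open ≡-Reasoning

  ℚ-ring : AlmostCommutativeRing _ _
  ℚ-ring = fromCommutativeRing +-*-commutativeRing (λ x → dec⇒maybe (0ℚ ≟ x))

  zq : ℤ → ℚ
  zq a = a / 1

  zq-unnormalised : ∀ a → toℚᵘ (zq a) ℚᵘ.≃ ℚᵘ.mkℚᵘ a 0
  zq-unnormalised a = toℚᵘ-fromℚᵘ (ℚᵘ.mkℚᵘ a 0)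

  zq-+ : ∀ a b → zq (a ℤ.+ b) ≡ zq a + zq b
  zq-+ a b = toℚᵘ-injective (ℚᵘP.≃-trans (zq-unnormalised (a ℤ.+ b)) (ℚᵘP.≃-trans (ℚᵘ.*≡* (cross a b))
    (ℚᵘP.≃-sym (ℚᵘP.≃-trans (toℚᵘ-homo-+ (zq a) (zq b)) (ℚᵘP.+-cong (zq-unnormalised a) (zq-unnormalised b))))))
    where
    cross : ∀ a b → (a ℤ.+ b) ℤ.* (+ 1 ℤ.* + 1) ≡ (a ℤ.* + 1 ℤ.+ b ℤ.* + 1) ℤ.* + 1
    cross = ℤ-Solver.solve-∀

  zq-* : ∀ a b → zq (a ℤ.* b) ≡ zq a * zq b
  zq-* a b = toℚᵘ-injective (ℚᵘP.≃-trans (zq-unnormalised (a ℤ.* b)) (ℚᵘP.≃-trans (ℚᵘ.*≡* (cross a b))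
    (ℚᵘP.≃-sym (ℚᵘP.≃-trans (toℚᵘ-homo-* (zq a) (zq b)) (ℚᵘP.*-cong (zq-unnormalised a) (zq-unnormalised b))))))
    where
    cross : ∀ a b → (a ℤ.* b) ℤ.* (+ 1 ℤ.* + 1) ≡ (a ℤ.* b) ℤ.* + 1
    cross = ℤ-Solver.solve-∀

  zq-neg : ∀ a → zq (ℤ.- a) ≡ - zq a
  zq-neg a = trans (cong zq (sym (ℤP.-1*i≡-i a))) (trans (zq-* (ℤ.- + 1) a) (minus-one (zq a)))
    where
    minus-one : ∀ x → (- 1ℚ) * x ≡ - x
    minus-one = solve-∀ ℚ-ring

  zq-injective : ∀ {a b} → zq a ≡ zq b → a ≡ b
  zq-injective {a} {b} e
    with ℚᵘP.≃-trans (ℚᵘP.≃-sym (zq-unnormalised a)) (ℚᵘP.≃-trans (toℚᵘ-cong e) (zq-unnormalised b))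
  ... | ℚᵘ.*≡* cross = trans (sym (ℤP.*-identityʳ a)) (trans cross (ℤP.*-identityʳ b))

  nq-+ : ∀ a b → nq (a ℕ.+ b) ≡ nq a + nq b
  nq-+ a b = trans (cong zq (ℤP.pos-+ a b)) (zq-+ (+ a) (+ b))

  nq-* : ∀ a b → nq (a ℕ.* b) ≡ nq a * nq b
  nq-* a b = trans (cong zq (ℤP.pos-* a b)) (zq-* (+ a) (+ b))

  nq-injective : ∀ {a b} → nq a ≡ nq b → a ≡ b
  nq-injective e = ℤP.+-injective (zq-injective e)

  nq≢0 : ∀ {n} → n ≢ 0 → nq n ≢ 0ℚ
  nq≢0 n≢0 e = n≢0 (nq-injective e)

  inv-inverseˡ : ∀ x → x ≢ 0ℚ → inv x * x ≡ 1ℚ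
  inv-inverseˡ x x≢0 with x ≟ 0ℚ
  ... | yes x≡0 = ⊥-elim (x≢0 x≡0)
  ... | no x≢0′ = *-inverseˡ x {{≢-nonZero x≢0′}}

  inv-inverseʳ : ∀ x → x ≢ 0ℚ → x * inv x ≡ 1ℚ
  inv-inverseʳ x x≢0 = trans (*-comm x (inv x)) (inv-inverseˡ x x≢0)

  inv-unique : ∀ x y → x * y ≡ 1ℚ → inv x ≡ y
  inv-unique x y xy≡1 = begin
    inv x             ≡⟨ *-identityʳ (inv x) ⟨
    inv x * 1ℚ        ≡⟨ cong (inv x *_) xy≡1 ⟨
    inv x * (x * y)   ≡⟨ *-assoc (inv x) x y ⟨
    (inv x * x) * y   ≡⟨ cong (_* y) (inv-inverseˡ x x≢0) ⟩
    1ℚ * y            ≡⟨ *-identityˡ y ⟩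
    y ∎
    where
    x≢0 : x ≢ 0ℚ
    x≢0 refl = 1≢0 (trans (sym xy≡1) (*-zeroˡ y))

  inv-* : ∀ x y → inv (x * y) ≡ inv x * inv y
  inv-* x y = by-cases (x ≟ 0ℚ) (y ≟ 0ℚ)
    where
    regroup : ∀ a b c d → (a * b) * (c * d) ≡ (c * a) * (d * b)
    regroup = solve-∀ ℚ-ring
    by-cases : Dec (x ≡ 0ℚ) → Dec (y ≡ 0ℚ) → inv (x * y) ≡ inv x * inv y
    by-cases (yes refl) _ = trans (cong inv (*-zeroˡ y)) (sym (*-zeroˡ (inv y)))
    by-cases (no _) (yes refl) = trans (cong inv (*-zeroʳ x)) (sym (*-zeroʳ (inv x)))
    by-cases (no x≢0) (no y≢0) = inv-unique (x * y) (inv x * inv y) (begin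
      (x * y) * (inv x * inv y)   ≡⟨ regroup x y (inv x) (inv y) ⟩
      (inv x * x) * (inv y * y)   ≡⟨ cong₂ _*_ (inv-inverseˡ x x≢0) (inv-inverseˡ y y≢0) ⟩
      1ℚ ∎)

  *-cancelʳ : ∀ x y z → z ≢ 0ℚ → x * z ≡ y * z → x ≡ y
  *-cancelʳ x y z z≢0 xz≡yz = begin
    x                ≡⟨ trans (cong (x *_) (inv-inverseʳ z z≢0)) (*-identityʳ x) ⟨
    x * (z * inv z)  ≡⟨ *-assoc x z (inv z) ⟨
    (x * z) * inv z  ≡⟨ cong (_* inv z) xz≡yz ⟩
    (y * z) * inv z  ≡⟨ *-assoc y z (inv z) ⟩
    y * (z * inv z)  ≡⟨ trans (cong (y *_) (inv-inverseʳ z z≢0)) (*-identityʳ y) ⟩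
    y ∎

  recip : ℕ → ℚ
  recip n = inv (nq n)

  recip-inverse : ∀ {n} → n ≢ 0 → recip n * nq n ≡ 1ℚ
  recip-inverse n≢0 = inv-inverseˡ _ (nq≢0 n≢0)

  recip-* : ∀ a b → recip (a ℕ.* b) ≡ recip a * recip b
  recip-* a b = trans (cong inv (nq-* a b)) (inv-* (nq a) (nq b))

  recip-+ : ∀ {a b} → a ≢ 0 → b ≢ 0 → recip a + recip b ≡ nq (a ℕ.+ b) * recip (a ℕ.* b)
  recip-+ {a} {b} a≢0 b≢0 = sym (begin
    nq (a ℕ.+ b) * recip (a ℕ.* b)                      ≡⟨ cong₂ _*_ (nq-+ a b) (recip-* a b) ⟩
    (nq a + nq b) * (recip a * recip b)                 ≡⟨ expand (nq a) (nq b) (recip a) (recip b) ⟩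
    (recip a * nq a) * recip b + (recip b * nq b) * recip a ≡⟨ cong₂ (λ u v → u * recip b + v * recip a) (recip-inverse a≢0) (recip-inverse b≢0) ⟩
    1ℚ * recip b + 1ℚ * recip a                         ≡⟨ cong₂ _+_ (*-identityˡ (recip b)) (*-identityˡ (recip a)) ⟩
    recip b + recip a                                   ≡⟨ +-comm (recip b) (recip a) ⟩
    recip a + recip b ∎)
    where
    expand : ∀ x y u v → (x + y) * (u * v) ≡ (u * x) * v + (v * y) * u
    expand = solve-∀ ℚ-ring

  solve-for : ∀ {a} x y → a ≢ 0 → nq a * x ≡ y → x ≡ recip a * y
  solve-for {a} x y a≢0 ax≡y = begin
    x                   ≡⟨ *-identityˡ x ⟨
    1ℚ * x              ≡⟨ cong (_* x) (recip-inverse a≢0) ⟨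
    (recip a * nq a) * x ≡⟨ *-assoc (recip a) (nq a) x ⟩
    recip a * (nq a * x) ≡⟨ cong (recip a *_) ax≡y ⟩
    recip a * y ∎

-- Reindexing lemmas for an iterated commutative operation
-- fold n f = f 1 ∙ f 2 ∙ ⋯ ∙ f n, known only through its defining equations;
-- instantiated below for sums (sumℚ) and products (prodℚ).
module Iterated
  (_∙_ : ℚ → ℚ → ℚ) (ε : ℚ)
  (∙-assoc : ∀ x y z → (x ∙ y) ∙ z ≡ x ∙ (y ∙ z))
  (∙-comm : ∀ x y → x ∙ y ≡ y ∙ x)
  (∙-identityʳ : ∀ x → x ∙ ε ≡ x)
  (fold : ℕ → (ℕ → ℚ) → ℚ)
  (fold-zero : ∀ f → fold 0 f ≡ ε)
  (fold-suc : ∀ n f → fold (suc n) f ≡ fold n f ∙ f (suc n))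
  where

  open import Data.Nat using (zero; _+_; _∸_; _≤_; s≤s; z≤n)
  open import Data.Nat.Properties using (+-suc; +-identityʳ; +-∸-assoc; m≤n⇒m≤1+n; ≤-refl; ≤-trans; m≤m+n; n≤1+n)
  open import Relation.Binary.PropositionalEquality using (sym; trans; cong; cong₂)
  open Relation.Binary.PropositionalEquality.≡-Reasoning

  ∙-identityˡ : ∀ x → ε ∙ x ≡ x
  ∙-identityˡ x = trans (∙-comm ε x) (∙-identityʳ x)

  swap-last : ∀ a b c → (a ∙ b) ∙ c ≡ (a ∙ c) ∙ b
  swap-last a b c = trans (∙-assoc a b c) (trans (cong (a ∙_) (∙-comm b c)) (sym (∙-assoc a c b)))

  swap-middle : ∀ a b c d → (a ∙ b) ∙ (c ∙ d) ≡ (a ∙ c) ∙ (b ∙ d)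
  swap-middle a b c d = begin
    (a ∙ b) ∙ (c ∙ d)  ≡⟨ ∙-assoc (a ∙ b) c d ⟨
    ((a ∙ b) ∙ c) ∙ d  ≡⟨ cong (_∙ d) (swap-last a b c) ⟩
    ((a ∙ c) ∙ b) ∙ d  ≡⟨ ∙-assoc (a ∙ c) b d ⟩
    (a ∙ c) ∙ (b ∙ d) ∎

  fold-cong : ∀ n {f g} → (∀ k → 1 ≤ k → k ≤ n → f k ≡ g k) → fold n f ≡ fold n g
  fold-cong zero {f} {g} _ = trans (fold-zero f) (sym (fold-zero g))
  fold-cong (suc n) {f} {g} f≗g = begin
    fold (suc n) f        ≡⟨ fold-suc n f ⟩
    fold n f ∙ f (suc n)  ≡⟨ cong₂ _∙_ (fold-cong n (λ k 1≤k k≤n → f≗g k 1≤k (m≤n⇒m≤1+n k≤n))) (f≗g (suc n) (s≤s z≤n) ≤-refl) ⟩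
    fold n g ∙ g (suc n)  ≡⟨ fold-suc n g ⟨
    fold (suc n) g ∎

  fold-ε : ∀ n → fold n (λ _ → ε) ≡ ε
  fold-ε zero = fold-zero (λ _ → ε)
  fold-ε (suc n) = trans (fold-suc n (λ _ → ε)) (trans (cong (_∙ ε) (fold-ε n)) (∙-identityʳ ε))

  fold-∙ : ∀ n f g → fold n (λ k → f k ∙ g k) ≡ fold n f ∙ fold n g
  fold-∙ zero f g = trans (fold-zero _) (sym (trans (cong₂ _∙_ (fold-zero f) (fold-zero g)) (∙-identityʳ ε)))
  fold-∙ (suc n) f g = begin
    fold (suc n) (λ k → f k ∙ g k)                   ≡⟨ fold-suc n _ ⟩
    fold n (λ k → f k ∙ g k) ∙ (f (suc n) ∙ g (suc n)) ≡⟨ cong (_∙ (f (suc n) ∙ g (suc n))) (fold-∙ n f g) ⟩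
    (fold n f ∙ fold n g) ∙ (f (suc n) ∙ g (suc n))  ≡⟨ swap-middle (fold n f) (fold n g) (f (suc n)) (g (suc n)) ⟩
    (fold n f ∙ f (suc n)) ∙ (fold n g ∙ g (suc n))  ≡⟨ cong₂ _∙_ (fold-suc n f) (fold-suc n g) ⟨
    fold (suc n) f ∙ fold (suc n) g ∎

  fold-shift : ∀ n f → fold (suc n) f ≡ f 1 ∙ fold n (λ k → f (suc k))
  fold-shift zero f = trans (fold-suc 0 f) (trans (cong (_∙ f 1) (fold-zero f))
    (trans (∙-identityˡ (f 1)) (sym (trans (cong (f 1 ∙_) (fold-zero _)) (∙-identityʳ (f 1))))))
  fold-shift (suc n) f = begin
    fold (suc (suc n)) f                               ≡⟨ fold-suc (suc n) f ⟩
    fold (suc n) f ∙ f (suc (suc n))                   ≡⟨ cong (_∙ f (suc (suc n))) (fold-shift n f) ⟩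
    (f 1 ∙ fold n (λ k → f (suc k))) ∙ f (suc (suc n)) ≡⟨ ∙-assoc (f 1) _ _ ⟩
    f 1 ∙ (fold n (λ k → f (suc k)) ∙ f (suc (suc n))) ≡⟨ cong (f 1 ∙_) (fold-suc n _) ⟨
    f 1 ∙ fold (suc n) (λ k → f (suc k)) ∎

  fold-split : ∀ m n f → fold (m + n) f ≡ fold m f ∙ fold n (λ k → f (m + k))
  fold-split m zero f = trans (cong (λ z → fold z f) (+-identityʳ m))
    (sym (trans (cong (fold m f ∙_) (fold-zero _)) (∙-identityʳ (fold m f))))
  fold-split m (suc n) f = begin
    fold (m + suc n) f                                     ≡⟨ cong (λ z → fold z f) (+-suc m n) ⟩
    fold (suc (m + n)) f                                   ≡⟨ fold-suc (m + n) f ⟩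
    fold (m + n) f ∙ f (suc (m + n))                       ≡⟨ cong₂ _∙_ (fold-split m n f) (cong f (sym (+-suc m n))) ⟩
    (fold m f ∙ fold n (λ k → f (m + k))) ∙ f (m + suc n)  ≡⟨ ∙-assoc (fold m f) _ _ ⟩
    fold m f ∙ (fold n (λ k → f (m + k)) ∙ f (m + suc n))  ≡⟨ cong (fold m f ∙_) (fold-suc n _) ⟨
    fold m f ∙ fold (suc n) (λ k → f (m + k)) ∎

  private
    double-suc : ∀ h → suc h + suc h ≡ suc (suc (h + h))
    double-suc h = cong suc (+-suc h h)

    fold-two : ∀ n f → fold (suc (suc n)) f ≡ (fold n f ∙ f (suc n)) ∙ f (suc (suc n))
    fold-two n f = trans (fold-suc (suc n) f) (cong (_∙ f (suc (suc n))) (fold-suc n f))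

  fold-reflect : ∀ h f → fold (h + h) f ≡ fold h (λ k → f k ∙ f (suc (h + h) ∸ k))
  fold-reflect zero f = trans (fold-zero f) (sym (fold-zero _))
  fold-reflect (suc h) f = begin
    fold (suc h + suc h) f                          ≡⟨ cong (λ z → fold z f) (double-suc h) ⟩
    fold (suc (suc (h + h))) f                      ≡⟨ fold-suc (suc (h + h)) f ⟩
    fold (suc (h + h)) f ∙ f last                   ≡⟨ cong (_∙ f last) (fold-shift (h + h) f) ⟩
    (f 1 ∙ fold (h + h) (λ k → f (suc k))) ∙ f last ≡⟨ cong (λ z → (f 1 ∙ z) ∙ f last) (fold-reflect h (λ k → f (suc k))) ⟩
    (f 1 ∙ inner) ∙ f last                          ≡⟨ swap-last (f 1) inner (f last) ⟩
    (f 1 ∙ f last) ∙ inner                          ≡⟨ cong₂ _∙_ (cong (λ z → f 1 ∙ f z) (sym (double-suc h))) (fold-cong h reindex) ⟩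
    (f 1 ∙ f (suc (suc h + suc h) ∸ 1)) ∙ fold h (λ k → f (suc k) ∙ f (suc (suc h + suc h) ∸ suc k)) ≡⟨ fold-shift h _ ⟨
    fold (suc h) (λ k → f k ∙ f (suc (suc h + suc h) ∸ k)) ∎
    where
    last = suc (suc (h + h))
    inner = fold h (λ k → f (suc k) ∙ f (suc (suc (h + h) ∸ k)))
    reindex : ∀ k → 1 ≤ k → k ≤ h → f (suc k) ∙ f (suc (suc (h + h) ∸ k)) ≡ f (suc k) ∙ f (suc (suc h + suc h) ∸ suc k)
    reindex k _ k≤h = cong (λ z → f (suc k) ∙ f z) (begin
      suc (suc (h + h) ∸ k) ≡⟨ +-∸-assoc 1 (≤-trans k≤h (≤-trans (m≤m+n h h) (n≤1+n _))) ⟨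
      suc (suc (h + h)) ∸ k ≡⟨ cong (_∸ k) (double-suc h) ⟨
      suc h + suc h ∸ k ∎)

  fold-parity : ∀ h f → fold (h + h) f ≡ fold h (λ k → f (k + k) ∙ f (k + k ∸ 1))
  fold-parity zero f = trans (fold-zero f) (sym (fold-zero _))
  fold-parity (suc h) f = begin
    fold (suc h + suc h) f                   ≡⟨ cong (λ z → fold z f) (double-suc h) ⟩
    fold (suc (suc (h + h))) f               ≡⟨ fold-two (h + h) f ⟩
    (fold (h + h) f ∙ f odd) ∙ f even        ≡⟨ cong (λ z → (z ∙ f odd) ∙ f even) (fold-parity h f) ⟩
    (paired ∙ f odd) ∙ f even                ≡⟨ ∙-assoc paired (f odd) (f even) ⟩
    paired ∙ (f odd ∙ f even)                ≡⟨ cong (paired ∙_) (∙-comm (f odd) (f even)) ⟩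
    paired ∙ (f even ∙ f odd)                ≡⟨ cong (λ z → paired ∙ (f z ∙ f (z ∸ 1))) (sym (double-suc h)) ⟩
    paired ∙ (f (suc h + suc h) ∙ f (suc h + suc h ∸ 1)) ≡⟨ fold-suc h _ ⟨
    fold (suc h) (λ k → f (k + k) ∙ f (k + k ∸ 1)) ∎
    where
    odd = suc (h + h)
    even = suc (suc (h + h))
    paired = fold h (λ k → f (k + k) ∙ f (k + k ∸ 1))

module Sums where

  open import Data.Nat as ℕ using (zero; _≤_)
  open import Data.Rational using (0ℚ; _+_; _*_; _-_; -_)
  open import Data.Rational.Properties using (+-assoc; +-comm; +-identityʳ; *-zeroʳ; *-distribˡ-+; neg-distrib-+)
  open import Relation.Binary.PropositionalEquality using (refl; sym; trans; cong)
  open RationalArithmetic using (nq-+)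
  open Binomial using (sumℕ)

  open Iterated _+_ 0ℚ +-assoc +-comm +-identityʳ sumℚ (λ _ → refl) (λ _ _ → refl) public
    using () renaming ( fold-cong to sum-cong; fold-∙ to sum-+; fold-shift to sum-shift
                      ; fold-split to sum-split; fold-reflect to sum-reflect; fold-parity to sum-parity)
  open Iterated _+_ 0ℚ +-assoc +-comm +-identityʳ sumℚ (λ _ → refl) (λ _ _ → refl) using (fold-ε)

  sum-vanish : ∀ n f → (∀ k → 1 ≤ k → k ≤ n → f k ≡ 0ℚ) → sumℚ n f ≡ 0ℚ
  sum-vanish n f f≡0 = trans (sum-cong n f≡0) (fold-ε n)

  sum-scale : ∀ n c f → sumℚ n (λ k → c * f k) ≡ c * sumℚ n f
  sum-scale zero c f = sym (*-zeroʳ c)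
  sum-scale (suc n) c f = trans (cong (_+ c * f (suc n)) (sum-scale n c f)) (sym (*-distribˡ-+ c _ _))

  sum-neg : ∀ n f → sumℚ n (λ k → - f k) ≡ - sumℚ n f
  sum-neg zero f = refl
  sum-neg (suc n) f = trans (cong (_+ - f (suc n)) (sum-neg n f)) (sym (neg-distrib-+ (sumℚ n f) _))

  sum-- : ∀ n f g → sumℚ n (λ k → f k - g k) ≡ sumℚ n f - sumℚ n g
  sum-- n f g = trans (sum-+ n f (λ k → - g k)) (cong (sumℚ n f +_) (sum-neg n g))

  sum-nq : ∀ n f → sumℚ n (λ k → nq (f k)) ≡ nq (sumℕ n f)
  sum-nq zero f = refl
  sum-nq (suc n) f = trans (cong (_+ nq (f (suc n))) (sum-nq n f)) (sym (nq-+ (sumℕ n f) (f (suc n))))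

module Products where

  open import Data.Nat as ℕ using (zero; _+_; _!)
  open import Data.Rational using (1ℚ; _*_)
  open import Data.Rational.Properties using (*-assoc; *-comm; *-identityʳ)
  open import Relation.Binary.PropositionalEquality using (refl; trans; cong)
  open RationalArithmetic using (nq-*)
  open Binomial using (rising)

  prodℚ : ℕ → (ℕ → ℚ) → ℚ
  prodℚ zero f = 1ℚ
  prodℚ (suc n) f = prodℚ n f * f (suc n)

  open Iterated _*_ 1ℚ *-assoc *-comm *-identityʳ prodℚ (λ _ → refl) (λ _ _ → refl) public
    using () renaming (fold-cong to prod-cong; fold-∙ to prod-*; fold-reflect to prod-reflect)

  nq-factorial : ∀ k → nq (k !) ≡ prodℚ k nq
  nq-factorial zero = refl
  nq-factorial (suc k) = trans (nq-* (suc k) (k !)) (trans (*-comm (nq (suc k)) (nq (k !))) (cong (_* nq (suc k)) (nq-factorial k)))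

  nq-rising : ∀ a k → nq (rising a k) ≡ prodℚ k (λ t → nq (a + t))
  nq-rising a zero = refl
  nq-rising a (suc k) = trans (nq-* (rising a k) (a + suc k)) (cong (_* nq (a + suc k)) (nq-rising a k))

-- The local ring ℤ_(p) ⊂ ℚ at a prime p and its ideals p^m ℤ_(p).
-- `Integral q` says q ∈ ℤ_(p); `Multiple m q` says q ∈ p^m ℤ_(p).
module Local (p : ℕ) (p-prime : Prime p) where

  open import Data.Nat as ℕ using (zero; _≤_; s≤s; z≤n)
  open import Data.Nat.Primality using (euclidsLemma; prime)
  import Data.Nat.Properties as ℕP
  open import Data.Nat.Divisibility using (_∣_; divides; ∣1⇒≡1; ∣-trans; n∣m*n; m∣m*n)
  open import Data.Nat.Coprimality using (coprime?)
  open import Data.Integer as ℤ using (ℤ; +_)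
  import Data.Integer.Properties as ℤP
  open import Data.Rational as ℚ using (0ℚ; 1ℚ; _+_; _*_; _-_; -_; toℚᵘ; mkℚ)
  open import Data.Rational.Properties
  import Data.Rational.Unnormalised as ℚᵘ
  import Data.Rational.Unnormalised.Properties as ℚᵘP
  open import Relation.Binary.PropositionalEquality
  open import Relation.Nullary using (¬_)
  open import Relation.Nullary.Decidable using (recompute)
  open import Data.Empty using (⊥-elim)
  open import Data.Sum using (inj₁; inj₂)
  open import Data.Product using (_,_)
  open import Tactic.RingSolver using (solve-∀)
  open RationalArithmetic
  open Products using (prodℚ)
  open ≡-Reasoning

  1<p : 1 ℕ.< p
  1<p = prime⇒1< p-prime
    where
    prime⇒1< : ∀ {q} → Prime q → 1 ℕ.< q
    prime⇒1< {q} (prime _) = ℕ.nonTrivial⇒n>1 q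

  p≢0 : p ≢ 0
  p≢0 p≡0 = ℕP.<⇒≢ (ℕP.<-trans (s≤s z≤n) 1<p) (sym p≡0)

  p∤1 : ¬ p ∣ 1
  p∤1 p∣1 = ℕP.<⇒≢ 1<p (sym (∣1⇒≡1 p∣1))

  ∤-* : ∀ {a b} → ¬ p ∣ a → ¬ p ∣ b → ¬ p ∣ (a ℕ.* b)
  ∤-* p∤a p∤b p∣ab with euclidsLemma _ _ p-prime p∣ab
  ... | inj₁ p∣a = p∤a p∣a
  ... | inj₂ p∣b = p∤b p∣b

  ∤⇒≢0 : ∀ {n} → ¬ p ∣ n → n ≢ 0
  ∤⇒≢0 p∤0 refl = p∤0 (divides 0 refl)

  record Integral (q : ℚ) : Set where
    constructor integral
    field
      numerator : ℤ
      denominator : ℕ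
      p∤denominator : ¬ p ∣ denominator
      q*denominator : q * nq denominator ≡ zq numerator

  integral-zq : ∀ a → Integral (zq a)
  integral-zq a = integral a 1 p∤1 (*-identityʳ (zq a))

  integral-nq : ∀ n → Integral (nq n)
  integral-nq n = integral-zq (+ n)

  integral-+ : ∀ {x y} → Integral x → Integral y → Integral (x + y)
  integral-+ {x} {y} (integral a₁ b₁ p∤b₁ e₁) (integral a₂ b₂ p∤b₂ e₂) =
    integral (a₁ ℤ.* + b₂ ℤ.+ a₂ ℤ.* + b₁) (b₁ ℕ.* b₂) (∤-* p∤b₁ p∤b₂) (begin
      (x + y) * nq (b₁ ℕ.* b₂)                  ≡⟨ cong ((x + y) *_) (nq-* b₁ b₂) ⟩
      (x + y) * (nq b₁ * nq b₂)                 ≡⟨ cross-multiply x y (nq b₁) (nq b₂) ⟩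
      (x * nq b₁) * nq b₂ + (y * nq b₂) * nq b₁ ≡⟨ cong₂ (λ u v → u * nq b₂ + v * nq b₁) e₁ e₂ ⟩
      zq a₁ * zq (+ b₂) + zq a₂ * zq (+ b₁)     ≡⟨ cong₂ _+_ (zq-* a₁ (+ b₂)) (zq-* a₂ (+ b₁)) ⟨
      zq (a₁ ℤ.* + b₂) + zq (a₂ ℤ.* + b₁)       ≡⟨ zq-+ (a₁ ℤ.* + b₂) (a₂ ℤ.* + b₁) ⟨
      zq (a₁ ℤ.* + b₂ ℤ.+ a₂ ℤ.* + b₁) ∎)
    where
    cross-multiply : ∀ x y u v → (x + y) * (u * v) ≡ (x * u) * v + (y * v) * u
    cross-multiply = solve-∀ ℚ-ring

  integral-* : ∀ {x y} → Integral x → Integral y → Integral (x * y)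
  integral-* {x} {y} (integral a₁ b₁ p∤b₁ e₁) (integral a₂ b₂ p∤b₂ e₂) =
    integral (a₁ ℤ.* a₂) (b₁ ℕ.* b₂) (∤-* p∤b₁ p∤b₂) (begin
      (x * y) * nq (b₁ ℕ.* b₂)   ≡⟨ cong ((x * y) *_) (nq-* b₁ b₂) ⟩
      (x * y) * (nq b₁ * nq b₂)  ≡⟨ swap-middle x y (nq b₁) (nq b₂) ⟩
      (x * nq b₁) * (y * nq b₂)  ≡⟨ cong₂ _*_ e₁ e₂ ⟩
      zq a₁ * zq a₂              ≡⟨ zq-* a₁ a₂ ⟨
      zq (a₁ ℤ.* a₂) ∎)
    where
    swap-middle : ∀ x y u v → (x * y) * (u * v) ≡ (x * u) * (y * v)
    swap-middle = solve-∀ ℚ-ring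

  integral-neg : ∀ {x} → Integral x → Integral (- x)
  integral-neg {x} (integral a b p∤b e) =
    integral (ℤ.- a) b p∤b (trans (sym (neg-distribˡ-* x (nq b))) (trans (cong -_ e) (sym (zq-neg a))))

  integral-- : ∀ {x y} → Integral x → Integral y → Integral (x - y)
  integral-- x∈ y∈ = integral-+ x∈ (integral-neg y∈)

  integral-inv : ∀ {n} → ¬ p ∣ n → Integral (inv (nq n))
  integral-inv {n} p∤n = integral (+ 1) n p∤n (inv-inverseˡ (nq n) (nq≢0 (∤⇒≢0 p∤n)))

  integral⇒p∤denominator : ∀ {r} → Integral r → ¬ p ∣ ℚ.denominatorℕ r
  integral⇒p∤denominator {r@(mkℚ n d coprime)} (integral a b p∤b e) p∣d = ℕP.<⇒≢ 1<p (sym (common-divisor (p∣n , p∣d)))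
    where
    unnormalised : toℚᵘ r ℚᵘ.* ℚᵘ.mkℚᵘ (+ b) 0 ℚᵘ.≃ ℚᵘ.mkℚᵘ a 0
    unnormalised = ℚᵘP.≃-trans (ℚᵘP.≃-sym (ℚᵘP.≃-trans (toℚᵘ-homo-* r (nq b)) (ℚᵘP.*-congˡ {toℚᵘ r} (zq-unnormalised (+ b)))))
                               (ℚᵘP.≃-trans (toℚᵘ-cong e) (zq-unnormalised a))
    cross : (n ℤ.* + b) ℤ.* + 1 ≡ a ℤ.* (+ suc d ℤ.* + 1)
    cross with unnormalised
    ... | ℚᵘ.*≡* eq = eq
    |n|b≡|a|d : ℤ.∣ n ∣ ℕ.* b ≡ ℤ.∣ a ∣ ℕ.* suc d
    |n|b≡|a|d = begin
      ℤ.∣ n ∣ ℕ.* b                  ≡⟨ ℤP.abs-* n (+ b) ⟨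
      ℤ.∣ n ℤ.* + b ∣                ≡⟨ cong ℤ.∣_∣ (ℤP.*-identityʳ (n ℤ.* + b)) ⟨
      ℤ.∣ (n ℤ.* + b) ℤ.* + 1 ∣      ≡⟨ cong ℤ.∣_∣ cross ⟩
      ℤ.∣ a ℤ.* (+ suc d ℤ.* + 1) ∣  ≡⟨ cong (λ z → ℤ.∣ a ℤ.* z ∣) (ℤP.*-identityʳ (+ suc d)) ⟩
      ℤ.∣ a ℤ.* + suc d ∣            ≡⟨ ℤP.abs-* a (+ suc d) ⟩
      ℤ.∣ a ∣ ℕ.* suc d ∎
    p∣n : p ∣ ℤ.∣ n ∣
    p∣n with euclidsLemma ℤ.∣ n ∣ b p-prime (subst (p ∣_) (sym |n|b≡|a|d) (∣-trans p∣d (n∣m*n ℤ.∣ a ∣)))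
    ... | inj₁ p∣n = p∣n
    ... | inj₂ p∣b = ⊥-elim (p∤b p∣b)
    common-divisor = recompute (coprime? ℤ.∣ n ∣ (suc d)) coprime

  record Multiple (m : ℕ) (q : ℚ) : Set where
    constructor multiple
    field
      cofactor : ℚ
      cofactor-integral : Integral cofactor
      q≡p^m*cofactor : q ≡ nq (p ℕ.^ m) * cofactor

  multiple⇒InPowZp : ∀ {m q} → Multiple m q → InPowZp p m q
  multiple⇒InPowZp (multiple r r∈ e) = r , e , integral⇒p∤denominator r∈

  integral⇒multiple : ∀ {q} → Integral q → Multiple 0 q
  integral⇒multiple {q} q∈ = multiple q q∈ (sym (*-identityˡ q))

  multiple⇒integral : ∀ {m q} → Multiple m q → Integral q
  multiple⇒integral {m} (multiple r r∈ refl) = integral-* (integral-nq (p ℕ.^ m)) r∈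

  multiple-≡ : ∀ {m x y} → x ≡ y → Multiple m x → Multiple m y
  multiple-≡ refl x∈ = x∈

  multiple-0 : ∀ {m} → Multiple m 0ℚ
  multiple-0 {m} = multiple 0ℚ (integral-nq 0) (sym (*-zeroʳ (nq (p ℕ.^ m))))

  multiple-+ : ∀ {m x y} → Multiple m x → Multiple m y → Multiple m (x + y)
  multiple-+ {m} (multiple r r∈ refl) (multiple s s∈ refl) =
    multiple (r + s) (integral-+ r∈ s∈) (sym (*-distribˡ-+ (nq (p ℕ.^ m)) r s))

  multiple-neg : ∀ {m x} → Multiple m x → Multiple m (- x)
  multiple-neg {m} (multiple r r∈ refl) = multiple (- r) (integral-neg r∈) (neg-distribʳ-* (nq (p ℕ.^ m)) r)

  multiple-- : ∀ {m x y} → Multiple m x → Multiple m y → Multiple m (x - y)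
  multiple-- x∈ y∈ = multiple-+ x∈ (multiple-neg y∈)

  multiple-* : ∀ {m n x y} → Multiple m x → Multiple n y → Multiple (m ℕ.+ n) (x * y)
  multiple-* {m} {n} (multiple r r∈ refl) (multiple s s∈ refl) = multiple (r * s) (integral-* r∈ s∈) (begin
    (nq (p ℕ.^ m) * r) * (nq (p ℕ.^ n) * s)  ≡⟨ swap-middle (nq (p ℕ.^ m)) r (nq (p ℕ.^ n)) s ⟩
    (nq (p ℕ.^ m) * nq (p ℕ.^ n)) * (r * s)  ≡⟨ cong (_* (r * s)) (nq-* (p ℕ.^ m) (p ℕ.^ n)) ⟨
    nq (p ℕ.^ m ℕ.* p ℕ.^ n) * (r * s)       ≡⟨ cong (λ z → nq z * (r * s)) (ℕP.^-distribˡ-+-* p m n) ⟨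
    nq (p ℕ.^ (m ℕ.+ n)) * (r * s) ∎)
    where
    swap-middle : ∀ a b c d → (a * b) * (c * d) ≡ (a * c) * (b * d)
    swap-middle = solve-∀ ℚ-ring

  integral*multiple : ∀ {m x y} → Integral x → Multiple m y → Multiple m (x * y)
  integral*multiple x∈ y∈ = multiple-* (integral⇒multiple x∈) y∈

  multiple*integral : ∀ {m x y} → Multiple m x → Integral y → Multiple m (x * y)
  multiple*integral {m} {x} {y} x∈ y∈ = multiple-≡ (*-comm y x) (integral*multiple y∈ x∈)

  multiple-weaken : ∀ {m k x} → Multiple (m ℕ.+ k) x → Multiple m x
  multiple-weaken {m} {k} (multiple r r∈ refl) =
    multiple (nq (p ℕ.^ k) * r) (integral-* (integral-nq (p ℕ.^ k)) r∈) (begin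
      nq (p ℕ.^ (m ℕ.+ k)) * r              ≡⟨ cong (λ z → nq z * r) (ℕP.^-distribˡ-+-* p m k) ⟩
      nq (p ℕ.^ m ℕ.* p ℕ.^ k) * r          ≡⟨ cong (_* r) (nq-* (p ℕ.^ m) (p ℕ.^ k)) ⟩
      (nq (p ℕ.^ m) * nq (p ℕ.^ k)) * r     ≡⟨ *-assoc (nq (p ℕ.^ m)) _ r ⟩
      nq (p ℕ.^ m) * (nq (p ℕ.^ k) * r) ∎)

  multiple-p : Multiple 1 (nq p)
  multiple-p = multiple 1ℚ (integral-nq 1) (sym (trans (*-identityʳ (nq (p ℕ.* 1))) (cong nq (ℕP.*-identityʳ p))))

  multiply-by-p : ∀ {m x} → Multiple m x → Multiple (suc m) (nq p * x)
  multiply-by-p x∈ = multiple-* multiple-p x∈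

  p⁻¹ : ℚ
  p⁻¹ = inv (nq p)

  p⁻¹*p : p⁻¹ * nq p ≡ 1ℚ
  p⁻¹*p = inv-inverseˡ (nq p) (nq≢0 p≢0)

  divide-by-p : ∀ {m x} → Multiple (suc m) x → Multiple m (p⁻¹ * x)
  divide-by-p {m} (multiple r r∈ refl) = multiple r r∈ (begin
    p⁻¹ * (nq (p ℕ.* p ℕ.^ m) * r)          ≡⟨ cong (λ z → p⁻¹ * (z * r)) (nq-* p (p ℕ.^ m)) ⟩
    p⁻¹ * ((nq p * nq (p ℕ.^ m)) * r)       ≡⟨ regroup p⁻¹ (nq p) (nq (p ℕ.^ m)) r ⟩
    (p⁻¹ * nq p) * (nq (p ℕ.^ m) * r)       ≡⟨ cong (_* (nq (p ℕ.^ m) * r)) p⁻¹*p ⟩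
    1ℚ * (nq (p ℕ.^ m) * r)                 ≡⟨ *-identityˡ _ ⟩
    nq (p ℕ.^ m) * r ∎)
    where
    regroup : ∀ a b c d → a * ((b * c) * d) ≡ (a * b) * (c * d)
    regroup = solve-∀ ℚ-ring

  ∣⇒multiple : ∀ {n} → p ∣ n → Multiple 1 (nq n)
  ∣⇒multiple (divides q refl) =
    multiple-≡ (trans (*-comm (nq p) (nq q)) (sym (nq-* q p))) (multiply-by-p (integral⇒multiple (integral-nq q)))

  multiple⇒∣ : ∀ {n} → Multiple 1 (nq n) → p ∣ n
  multiple⇒∣ {n} (multiple r (integral a b p∤b rb≡a) n≡pr) with euclidsLemma n b p-prime p∣nb
    where
    nb≡pa : nq (n ℕ.* b) ≡ zq (+ p ℤ.* a)
    nb≡pa = begin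
      nq (n ℕ.* b)               ≡⟨ nq-* n b ⟩
      nq n * nq b                ≡⟨ cong (_* nq b) n≡pr ⟩
      (nq (p ℕ.* 1) * r) * nq b  ≡⟨ *-assoc (nq (p ℕ.* 1)) r (nq b) ⟩
      nq (p ℕ.* 1) * (r * nq b)  ≡⟨ cong₂ _*_ (cong nq (ℕP.*-identityʳ p)) rb≡a ⟩
      nq p * zq a                ≡⟨ zq-* (+ p) a ⟨
      zq (+ p ℤ.* a) ∎
    p∣nb : p ∣ n ℕ.* b
    p∣nb = subst (p ∣_) (sym (trans (cong ℤ.∣_∣ (zq-injective {+ (n ℕ.* b)} {+ p ℤ.* a} nb≡pa)) (ℤP.abs-* (+ p) a))) (m∣m*n ℤ.∣ a ∣)
  ... | inj₁ p∣n = p∣n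
  ... | inj₂ p∣b = ⊥-elim (p∤b p∣b)

  multiple-sum : ∀ {m} n f → (∀ k → 1 ≤ k → k ≤ n → Multiple m (f k)) → Multiple m (sumℚ n f)
  multiple-sum zero f _ = multiple-0
  multiple-sum (suc n) f f∈ = multiple-+ (multiple-sum n f (λ k 1≤k k≤n → f∈ k 1≤k (ℕP.m≤n⇒m≤1+n k≤n))) (f∈ (suc n) (s≤s z≤n) ℕP.≤-refl)

  integral-prod : ∀ n f → (∀ k → 1 ≤ k → k ≤ n → Integral (f k)) → Integral (prodℚ n f)
  integral-prod zero f _ = integral-nq 1
  integral-prod (suc n) f f∈ = integral-* (integral-prod n f (λ k 1≤k k≤n → f∈ k 1≤k (ℕP.m≤n⇒m≤1+n k≤n))) (f∈ (suc n) (s≤s z≤n) ℕP.≤-refl)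

  prod-congruence : ∀ {m} n a b → (∀ k → 1 ≤ k → k ≤ n → Integral (a k)) → (∀ k → 1 ≤ k → k ≤ n → Integral (b k))
    → (∀ k → 1 ≤ k → k ≤ n → Multiple m (a k - b k)) → Multiple m (prodℚ n a - prodℚ n b)
  prod-congruence zero a b _ _ _ = multiple-≡ (sym (+-inverseʳ 1ℚ)) multiple-0
  prod-congruence (suc n) a b a∈ b∈ a≡b = multiple-≡ (sym (telescope (prodℚ n a) (prodℚ n b) (a (suc n)) (b (suc n))))
    (multiple-+ (multiple*integral (prod-congruence n a b (below a∈) (below b∈) (below a≡b)) (a∈ (suc n) (s≤s z≤n) ℕP.≤-refl))
                (integral*multiple (integral-prod n b (below b∈)) (a≡b (suc n) (s≤s z≤n) ℕP.≤-refl)))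
    where
    below : ∀ {P : ℕ → Set} → (∀ k → 1 ≤ k → k ≤ suc n → P k) → ∀ k → 1 ≤ k → k ≤ n → P k
    below P k 1≤k k≤n = P k 1≤k (ℕP.m≤n⇒m≤1+n k≤n)
    telescope : ∀ A B x y → A * x - B * y ≡ (A - B) * x + B * (x - y)
    telescope = solve-∀ ℚ-ring

  prod-expansion : ∀ n y → (∀ k → 1 ≤ k → k ≤ n → Multiple 2 (y k)) → Multiple 4 (prodℚ n (λ k → 1ℚ + y k) - 1ℚ - sumℚ n y)
  prod-expansion zero y _ = multiple-≡ (sym (+-inverseʳ 1ℚ)) multiple-0
  prod-expansion (suc n) y y∈ = multiple-≡ (sym (expand Π Σ yₙ))
    (multiple-+ (multiple-+ remainder (multiple-* {2} {2} yₙ∈ Σ∈)) (multiple-weaken {4} {2} (multiple-* {2} {4} yₙ∈ remainder)))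
    where
    y∈′ : ∀ k → 1 ≤ k → k ≤ n → Multiple 2 (y k)
    y∈′ k 1≤k k≤n = y∈ k 1≤k (ℕP.m≤n⇒m≤1+n k≤n)
    Π = prodℚ n (λ k → 1ℚ + y k)
    Σ = sumℚ n y
    yₙ = y (suc n)
    remainder : Multiple 4 (Π - 1ℚ - Σ)
    remainder = prod-expansion n y y∈′
    yₙ∈ : Multiple 2 yₙ
    yₙ∈ = y∈ (suc n) (s≤s z≤n) ℕP.≤-refl
    Σ∈ : Multiple 2 Σ
    Σ∈ = multiple-sum n y y∈′
    expand : ∀ P S y → P * (1ℚ + y) - 1ℚ - (S + y) ≡ ((P - 1ℚ - S) + y * S) + y * (P - 1ℚ - S)
    expand = solve-∀ ℚ-ring

  congruent⇒multiple : ∀ {a b} c d → a ℕ.+ p ℕ.* c ≡ b ℕ.+ p ℕ.* d → Multiple 1 (nq b - nq a)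
  congruent⇒multiple {a} {b} c d a+pc≡b+pd =
    multiple-≡ (sym (difference (nq a) (nq b) (nq p) (nq c) (nq d) cast))
               (multiply-by-p (integral⇒multiple (integral-- (integral-nq c) (integral-nq d))))
    where
    cast : nq a + nq p * nq c ≡ nq b + nq p * nq d
    cast = begin
      nq a + nq p * nq c        ≡⟨ cong (λ z → nq a + z) (nq-* p c) ⟨
      nq a + nq (p ℕ.* c)       ≡⟨ nq-+ a (p ℕ.* c) ⟨
      nq (a ℕ.+ p ℕ.* c)        ≡⟨ cong nq a+pc≡b+pd ⟩
      nq (b ℕ.+ p ℕ.* d)        ≡⟨ nq-+ b (p ℕ.* d) ⟩
      nq b + nq (p ℕ.* d)       ≡⟨ cong (λ z → nq b + z) (nq-* p d) ⟩
      nq b + nq p * nq d ∎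
    difference : ∀ x y P u v → x + P * u ≡ y + P * v → y - x ≡ P * (u - v)
    difference x y P u v e = begin
      y - x                      ≡⟨ add-sub x y P v ⟩
      (y + P * v) - P * v - x    ≡⟨ cong (λ z → z - P * v - x) e ⟨
      (x + P * u) - P * v - x    ≡⟨ collect x P u v ⟩
      P * (u - v) ∎
      where
      add-sub : ∀ x y P v → y - x ≡ (y + P * v) - P * v - x
      add-sub = solve-∀ ℚ-ring
      collect : ∀ x P u v → (x + P * u) - P * v - x ≡ P * (u - v)
      collect = solve-∀ ℚ-ring

  recip-congruence : ∀ {m a b} → ¬ p ∣ a → ¬ p ∣ b → Multiple m (nq b - nq a) → Multiple m (recip a - recip b)
  recip-congruence {m} {a} {b} p∤a p∤b b≡a =
    multiple-≡ (sym (cross (recip a) (recip b) (nq a) (nq b) (recip-inverse (∤⇒≢0 p∤a)) (recip-inverse (∤⇒≢0 p∤b))))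
               (integral*multiple (integral-* (integral-inv p∤a) (integral-inv p∤b)) b≡a)
    where
    cross : ∀ u v x y → u * x ≡ 1ℚ → v * y ≡ 1ℚ → u - v ≡ (u * v) * (y - x)
    cross u v x y ux≡1 vy≡1 = begin
      u - v                          ≡⟨ cong₂ _-_ (trans (cong (u *_) vy≡1) (*-identityʳ u)) (trans (cong (v *_) ux≡1) (*-identityʳ v)) ⟨
      u * (v * y) - v * (u * x)      ≡⟨ regroup u v x y ⟩
      (u * v) * (y - x) ∎
      where
      regroup : ∀ u v x y → u * (v * y) - v * (u * x) ≡ (u * v) * (y - x)
      regroup = solve-∀ ℚ-ring

module Coefficients where

  open import Data.Nat as ℕ using (zero; _≤_; _∸_; s≤s)
  import Data.Nat.Properties as ℕP
  open import Data.Rational using (0ℚ; 1ℚ; _+_; _*_; _-_)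
  open import Data.Rational.Properties using (+-identityˡ; +-identityʳ; *-identityʳ; *-zeroˡ; *-zeroʳ)
  open import Relation.Binary.PropositionalEquality
  open import Relation.Nullary using (Dec; yes; no; isYes)
  open import Data.Bool using (if_then_else_)
  open import Data.Empty using (⊥-elim)
  open import Tactic.RingSolver using (solve-∀)
  open RationalArithmetic using (ℚ-ring)
  open Sums
  open ≡-Reasoning

  monomial-same : ∀ i → monomial i i ≡ 1ℚ
  monomial-same i = select (i ℕ.≟ i)
    where
    select : (d : Dec (i ≡ i)) → (if isYes d then 1ℚ else 0ℚ) ≡ 1ℚ
    select (yes _) = refl
    select (no i≢i) = ⊥-elim (i≢i refl)

  monomial-other : ∀ k i → k ≢ i → monomial k i ≡ 0ℚ
  monomial-other k i k≢i = select (k ℕ.≟ i)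
    where
    select : (d : Dec (k ≡ i)) → (if isYes d then 1ℚ else 0ℚ) ≡ 0ℚ
    select (yes k≡i) = ⊥-elim (k≢i k≡i)
    select (no _) = refl

  monomial-sum-outside : ∀ n (a : ℕ → ℚ) i → (∀ k → 1 ≤ k → k ≤ n → k ≢ i) → sumℚ n (λ k → a k * monomial k i) ≡ 0ℚ
  monomial-sum-outside n a i outside =
    sum-vanish n _ (λ k 1≤k k≤n → trans (cong (a k *_) (monomial-other k i (outside k 1≤k k≤n))) (*-zeroʳ (a k)))

  monomial-sum-inside : ∀ n (a : ℕ → ℚ) i → 1 ≤ i → i ≤ n → sumℚ n (λ k → a k * monomial k i) ≡ a i
  monomial-sum-inside zero a (suc i) _ ()
  monomial-sum-inside (suc n) a i 1≤i i≤n with i ℕ.≟ suc n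
  ... | yes refl = begin
    sumℚ n (λ k → a k * monomial k i) + a i * monomial i i
      ≡⟨ cong₂ _+_ (monomial-sum-outside n a i (λ k _ k≤n k≡i → ℕP.<-irrefl k≡i (s≤s k≤n))) (cong (a i *_) (monomial-same i)) ⟩
    0ℚ + a i * 1ℚ ≡⟨ trans (+-identityˡ _) (*-identityʳ (a i)) ⟩
    a i ∎
  ... | no i≢n+1 = begin
    sumℚ n (λ k → a k * monomial k i) + a (suc n) * monomial (suc n) i
      ≡⟨ cong₂ _+_ (monomial-sum-inside n a i 1≤i (ℕP.≤-pred (ℕP.≤∧≢⇒< i≤n i≢n+1)))
                   (cong (a (suc n) *_) (monomial-other (suc n) i (λ n+1≡i → i≢n+1 (sym n+1≡i)))) ⟩
    a i + a (suc n) * 0ℚ ≡⟨ trans (cong (a i +_) (*-zeroʳ (a (suc n)))) (+-identityʳ (a i)) ⟩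
    a i ∎

  sumP-coefficient : ∀ n F i → sumP n F i ≡ sumℚ n (λ k → F k i)
  sumP-coefficient zero F zero = refl
  sumP-coefficient zero F (suc i) = refl
  sumP-coefficient (suc n) F i = cong (_+ F (suc n) i) (sumP-coefficient n F i)

  twoMinusT-⊛-zero : ∀ f → (twoMinusT ⊛ f) 0 ≡ nq 2 * f 0
  twoMinusT-⊛-zero f = +-identityˡ _

  twoMinusT-⊛-suc : ∀ f i → (twoMinusT ⊛ f) (suc i) ≡ nq 2 * f (suc i) - f i
  twoMinusT-⊛-suc f i = begin
    sumℚ (suc (suc i)) g                            ≡⟨ sum-shift (suc i) g ⟩
    g 1 + sumℚ (suc i) (λ k → g (suc k))            ≡⟨ cong (g 1 +_) (sum-shift i (λ k → g (suc k))) ⟩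
    g 1 + (g 2 + sumℚ i (λ k → g (suc (suc k))))    ≡⟨ cong (λ z → g 1 + (g 2 + z)) (sum-vanish i _ higher) ⟩
    g 1 + (g 2 + 0ℚ)                                ≡⟨ simplify (f (suc i)) (f i) ⟩
    nq 2 * f (suc i) - f i ∎
    where
    g : ℕ → ℚ
    g j = twoMinusT (j ∸ 1) * f (suc i ∸ (j ∸ 1))
    higher : ∀ k → 1 ≤ k → k ≤ i → g (suc (suc k)) ≡ 0ℚ
    higher (suc k) _ _ = *-zeroˡ (f (suc i ∸ suc (suc k)))
    simplify : ∀ a b → (nq 2 - 0ℚ) * a + ((0ℚ - 1ℚ) * b + 0ℚ) ≡ nq 2 * a - b
    simplify = solve-∀ ℚ-ring

module LucasAtTwoMinusT where

  open import Data.Nat as ℕ using (zero; s≤s; z≤n)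
  open import Data.Rational using (0ℚ; 1ℚ; _+_; _*_; _-_; -_)
  open import Data.Rational.Properties using (*-zeroʳ)
  open import Relation.Binary.PropositionalEquality
  open import Tactic.RingSolver using (solve-∀)
  open RationalArithmetic using (ℚ-ring; nq-+; nq-*)
  open Binomial using (lucasNum; lucasNum-rec; lucasNum-vanish)
  open Coefficients using (twoMinusT-⊛-zero; twoMinusT-⊛-suc)
  open ≡-Reasoning

  sign : ℕ → ℚ
  sign zero = 1ℚ
  sign (suc n) = - sign n

  lucasCoeff : ℕ → ℕ → ℚ
  lucasCoeff k i = sign i * nq (lucasNum k i)

  lucasCoeff-vanish : ∀ k i → k ℕ.< i → lucasCoeff k i ≡ 0ℚ
  lucasCoeff-vanish k i k<i = trans (cong (λ z → sign i * nq z) (lucasNum-vanish k i k<i)) (*-zeroʳ (sign i))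

  private
    lucasNum-recℚ : ∀ k j → nq (lucasNum (2 ℕ.+ k) (suc j)) + nq (lucasNum k (suc j))
                          ≡ nq 2 * nq (lucasNum (suc k) (suc j)) + nq (lucasNum (suc k) j)
    lucasNum-recℚ k j = begin
      nq a + nq b                  ≡⟨ nq-+ a b ⟨
      nq (a ℕ.+ b)                 ≡⟨ cong nq (lucasNum-rec k j) ⟩
      nq (2 ℕ.* c ℕ.+ d)           ≡⟨ nq-+ (2 ℕ.* c) d ⟩
      nq (2 ℕ.* c) + nq d          ≡⟨ cong (_+ nq d) (nq-* 2 c) ⟩
      nq 2 * nq c + nq d ∎
      where
      a = lucasNum (2 ℕ.+ k) (suc j)
      b = lucasNum k (suc j)
      c = lucasNum (suc k) (suc j)
      d = lucasNum (suc k) j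

    signed-rec : ∀ s a b c d → a + b ≡ nq 2 * c + d → (- s) * a ≡ nq 2 * ((- s) * c) - s * d - (- s) * b
    signed-rec s a b c d a+b≡ = begin
      (- s) * a                              ≡⟨ add-sub s a b ⟩
      (- s) * ((a + b) - b)                  ≡⟨ cong (λ z → (- s) * (z - b)) a+b≡ ⟩
      (- s) * ((nq 2 * c + d) - b)           ≡⟨ distribute s b c d ⟩
      nq 2 * ((- s) * c) - s * d - (- s) * b ∎
      where
      add-sub : ∀ s a b → (- s) * a ≡ (- s) * ((a + b) - b)
      add-sub = solve-∀ ℚ-ring
      distribute : ∀ s b c d → (- s) * ((nq 2 * c + d) - b) ≡ nq 2 * ((- s) * c) - s * d - (- s) * b
      distribute = solve-∀ ℚ-ring

  lucas-coefficient : ∀ k i → lucas twoMinusT k i ≡ lucasCoeff k i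
  lucas-coefficient zero zero = refl
  lucas-coefficient zero (suc j) = sym (lucasCoeff-vanish 0 (suc j) (s≤s z≤n))
  lucas-coefficient (suc zero) zero = refl
  lucas-coefficient (suc zero) (suc zero) = refl
  lucas-coefficient (suc zero) (suc (suc j)) = sym (lucasCoeff-vanish 1 (suc (suc j)) (s≤s (s≤s z≤n)))
  lucas-coefficient (suc (suc k)) zero = begin
    (twoMinusT ⊛ lucas twoMinusT (suc k)) 0 - lucas twoMinusT k 0
      ≡⟨ cong₂ _-_ (twoMinusT-⊛-zero (lucas twoMinusT (suc k))) (lucas-coefficient k 0) ⟩
    nq 2 * lucas twoMinusT (suc k) 0 - lucasCoeff k 0
      ≡⟨ cong (λ z → nq 2 * z - lucasCoeff k 0) (lucas-coefficient (suc k) 0) ⟩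
    nq 2 * lucasCoeff (suc k) 0 - lucasCoeff k 0 ≡⟨⟩
    lucasCoeff (suc (suc k)) 0 ∎
  lucas-coefficient (suc (suc k)) (suc j) = begin
    (twoMinusT ⊛ lucas twoMinusT (suc k)) (suc j) - lucas twoMinusT k (suc j)
      ≡⟨ cong₂ _-_ (twoMinusT-⊛-suc (lucas twoMinusT (suc k)) j) (lucas-coefficient k (suc j)) ⟩
    nq 2 * lucas twoMinusT (suc k) (suc j) - lucas twoMinusT (suc k) j - lucasCoeff k (suc j)
      ≡⟨ cong₂ (λ a b → nq 2 * a - b - lucasCoeff k (suc j)) (lucas-coefficient (suc k) (suc j)) (lucas-coefficient (suc k) j) ⟩
    nq 2 * lucasCoeff (suc k) (suc j) - lucasCoeff (suc k) j - lucasCoeff k (suc j)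
      ≡⟨ signed-rec (sign j) _ _ _ _ (lucasNum-recℚ k j) ⟨
    lucasCoeff (suc (suc k)) (suc j) ∎

module Wolstenholme (h : ℕ) (p-prime : Prime (suc (h ℕ.+ h))) (2≤h : 2 ℕ.≤ h) where

  open import Data.Nat as ℕ using (_∸_; _≤_; s≤s; z≤n; _!)
  import Data.Nat.Properties as ℕP
  import Data.Nat.Tactic.RingSolver as ℕ-Solver
  open import Data.Nat.Divisibility using (_∣_; ∣⇒≤; ∣m+n∣m⇒∣n; ∣-refl)
  open import Data.Nat.Combinatorics using (_C_)
  open import Data.Rational using (0ℚ; 1ℚ; _+_; _*_; _-_; -_)
  open import Data.Rational.Properties using (*-identityˡ; *-identityʳ; *-comm; *-assoc)
  open import Relation.Binary.PropositionalEquality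
  open import Relation.Nullary using (¬_)
  open import Tactic.RingSolver using (solve-∀)
  open RationalArithmetic
  open Sums
  open Products
  open Binomial using (binom; binom≡C; rising; binom-rising; factorial≢0)
  open ≡-Reasoning

  p : ℕ
  p = suc (h ℕ.+ h)

  open Local p p-prime

  p∤small : ∀ m → 1 ≤ m → m < p → ¬ p ∣ m
  p∤small (suc m) _ m<p p∣m = ℕP.<-irrefl refl (ℕP.<-≤-trans m<p (∣⇒≤ p∣m))

  p∤2 : ¬ p ∣ 2
  p∤2 = p∤small 2 (s≤s z≤n) (s≤s (ℕP.≤-trans 2≤h (ℕP.m≤m+n h h)))

  -- The only place where p > 3 is needed.
  p∤3 : ¬ p ∣ 3
  p∤3 = p∤small 3 (s≤s z≤n) (s≤s (ℕP.+-mono-≤ 2≤h (ℕP.≤-trans (s≤s z≤n) 2≤h)))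

  k<p : ∀ {k} → k ≤ h → k < p
  k<p k≤h = s≤s (ℕP.≤-trans k≤h (ℕP.m≤m+n h h))

  p∤k : ∀ {k} → 1 ≤ k → k ≤ h → ¬ p ∣ k
  p∤k {k} 1≤k k≤h = p∤small k 1≤k (k<p k≤h)

  p∤p∸k : ∀ {k} → 1 ≤ k → k ≤ h → ¬ p ∣ (p ∸ k)
  p∤p∸k {suc k} _ k≤h = p∤small (p ∸ suc k) (ℕP.m<n⇒0<n∸m (k<p k≤h)) (s≤s (ℕP.m∸n≤m (h ℕ.+ h) k))

  complement : ∀ {k} → k ≤ h → (p ∸ k) ℕ.+ k ≡ p
  complement k≤h = ℕP.m∸n+n≡m (ℕP.<⇒≤ (k<p k≤h))

  complement′ : ∀ {k} → k ≤ h → k ℕ.+ (p ∸ k) ≡ p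
  complement′ k≤h = ℕP.m+[n∸m]≡n (ℕP.<⇒≤ (k<p k≤h))

  recipSq : ℕ → ℚ
  recipSq n = recip (n ℕ.* n)

  p∤square : ∀ {n} → ¬ p ∣ n → ¬ p ∣ (n ℕ.* n)
  p∤square p∤n = ∤-* p∤n p∤n

  recipSq-double : ∀ k → recipSq (k ℕ.+ k) ≡ recip 4 * recipSq k
  recipSq-double k = trans (cong recip (four-times k)) (recip-* 4 (k ℕ.* k))
    where
    four-times : ∀ k → (k ℕ.+ k) ℕ.* (k ℕ.+ k) ≡ 4 ℕ.* (k ℕ.* k)
    four-times = ℕ-Solver.solve-∀

  recipSq-shift : ∀ m → 1 ≤ m → m < p → Multiple 1 (recipSq m - recipSq (p ℕ.+ m))
  recipSq-shift m 1≤m m<p = recip-congruence (p∤square p∤m) (p∤square p∤p+m)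
    (congruent⇒multiple (p ℕ.+ m ℕ.+ m) 0 (square-shift p m))
    where
    p∤m : ¬ p ∣ m
    p∤m = p∤small m 1≤m m<p
    p∤p+m : ¬ p ∣ (p ℕ.+ m)
    p∤p+m p∣p+m = p∤m (∣m+n∣m⇒∣n p∣p+m ∣-refl)
    square-shift : ∀ p m → m ℕ.* m ℕ.+ p ℕ.* (p ℕ.+ m ℕ.+ m) ≡ (p ℕ.+ m) ℕ.* (p ℕ.+ m) ℕ.+ p ℕ.* 0
    square-shift = ℕ-Solver.solve-∀

  recipSq-reflect : ∀ k → 1 ≤ k → k ≤ h → Multiple 1 (recipSq (p ∸ k) - recipSq k)
  recipSq-reflect k 1≤k k≤h = recip-congruence (p∤square (p∤p∸k 1≤k k≤h)) (p∤square (p∤k 1≤k k≤h))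
    (congruent⇒multiple {(p ∸ k) ℕ.* (p ∸ k)} {k ℕ.* k} (k ℕ.+ k) p (subst (λ q → (p ∸ k) ℕ.* (p ∸ k) ℕ.+ q ℕ.* (k ℕ.+ k) ≡ k ℕ.* k ℕ.+ q ℕ.* q)
                                           (complement k≤h) (sym (square-reflect (p ∸ k) k))))
    where
    square-reflect : ∀ a k → k ℕ.* k ℕ.+ (a ℕ.+ k) ℕ.* (a ℕ.+ k) ≡ a ℕ.* a ℕ.+ (a ℕ.+ k) ℕ.* (k ℕ.+ k)
    square-reflect = ℕ-Solver.solve-∀

  S₂ : ℚ
  S₂ = sumℚ (h ℕ.+ h) recipSq

  -- Splitting S₂ by parity and reducing the even part gives
  -- S₂ - S₂/4 = Σ_{k=1}^{h} (1/(2k-1)² - 1/(p+2k-1)²).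
  three-quarters-S₂ : S₂ - recip 4 * S₂ ≡ sumℚ h (λ k → recipSq (k ℕ.+ k ∸ 1) - recipSq (h ℕ.+ k ℕ.+ (h ℕ.+ k)))
  three-quarters-S₂ = begin
    S₂ - recip 4 * S₂
      ≡⟨ cong₂ _-_ (sum-parity h recipSq) (trans (sym (sum-scale (h ℕ.+ h) (recip 4) recipSq)) (sum-cong (h ℕ.+ h) (λ k _ _ → sym (recipSq-double k)))) ⟩
    sumℚ h (λ k → even k + odd k) - sumℚ (h ℕ.+ h) even
      ≡⟨ cong₂ _-_ (sum-+ h even odd) (sum-split h h even) ⟩
    (sumℚ h even + sumℚ h odd) - (sumℚ h even + sumℚ h (λ k → even (h ℕ.+ k)))
      ≡⟨ cancel (sumℚ h even) (sumℚ h odd) _ ⟩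
    sumℚ h odd - sumℚ h (λ k → even (h ℕ.+ k))
      ≡⟨ sum-- h odd (λ k → even (h ℕ.+ k)) ⟨
    sumℚ h (λ k → odd k - even (h ℕ.+ k)) ∎
    where
    even odd : ℕ → ℚ
    even k = recipSq (k ℕ.+ k)
    odd k = recipSq (k ℕ.+ k ∸ 1)
    cancel : ∀ a b c → (a + b) - (a + c) ≡ b - c
    cancel = solve-∀ ℚ-ring

  -- Σ_{k=1}^{p-1} 1/k² ≡ 0 (mod p): multiply three-quarters-S₂ by 4/3, using p ∤ 3.
  inverse-squares : Multiple 1 S₂
  inverse-squares = multiple-≡ (undo-three-quarters (recip-inverse {4} (λ ())) (recip-inverse {3} (λ ())))
    (integral*multiple (integral-* (integral-nq 4) (integral-inv p∤3))
      (multiple-≡ (sym three-quarters-S₂) (multiple-sum h _ term)))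
    where
    -- 2(h+k) = p + (2k-1): the even numbers beyond p are p plus the odd numbers below p.
    term : ∀ k → 1 ≤ k → k ≤ h → Multiple 1 (recipSq (k ℕ.+ k ∸ 1) - recipSq (h ℕ.+ k ℕ.+ (h ℕ.+ k)))
    term (suc k) _ k≤h = multiple-≡ (cong (λ z → recipSq (suc k ℕ.+ suc k ∸ 1) - recipSq z) (sym (even-shift h k)))
      (recipSq-shift (k ℕ.+ suc k) (ℕP.≤-trans (s≤s z≤n) (ℕP.m≤n+m (suc k) k)) (s≤s (ℕP.+-mono-≤ (ℕP.≤-trans (ℕP.n≤1+n k) k≤h) k≤h)))
      where
      even-shift : ∀ h k → (h ℕ.+ suc k) ℕ.+ (h ℕ.+ suc k) ≡ suc (h ℕ.+ h) ℕ.+ (k ℕ.+ suc k)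
      even-shift = ℕ-Solver.solve-∀
    undo-three-quarters : recip 4 * nq 4 ≡ 1ℚ → recip 3 * nq 3 ≡ 1ℚ → (nq 4 * recip 3) * (S₂ - recip 4 * S₂) ≡ S₂
    undo-three-quarters e₄ e₃ = begin
      (nq 4 * recip 3) * (S₂ - recip 4 * S₂)           ≡⟨ expand (recip 3) (recip 4) S₂ ⟩
      (nq 3 + 1ℚ) * recip 3 * S₂ - (recip 4 * nq 4) * recip 3 * S₂ ≡⟨ cong (λ z → (nq 3 + 1ℚ) * recip 3 * S₂ - z * recip 3 * S₂) e₄ ⟩
      (nq 3 + 1ℚ) * recip 3 * S₂ - 1ℚ * recip 3 * S₂  ≡⟨ simplify (recip 3) S₂ ⟩
      (recip 3 * nq 3) * S₂                            ≡⟨ cong (_* S₂) e₃ ⟩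
      1ℚ * S₂                                          ≡⟨ *-identityˡ S₂ ⟩
      S₂ ∎
      where
      expand : ∀ r₃ r₄ s → (nq 4 * r₃) * (s - r₄ * s) ≡ (nq 3 + 1ℚ) * r₃ * s - (r₄ * nq 4) * r₃ * s
      expand = solve-∀ ℚ-ring
      simplify : ∀ r₃ s → (nq 3 + 1ℚ) * r₃ * s - 1ℚ * r₃ * s ≡ (r₃ * nq 3) * s
      simplify = solve-∀ ℚ-ring

  -- S₁ = Σ_{k=1}^{h} 1/k² ≡ 0 (mod p), from S₂ ≡ 2 S₁ (pairing k with p - k).
  S₁ : ℚ
  S₁ = sumℚ h recipSq

  half-inverse-squares : Multiple 1 S₁
  half-inverse-squares = multiple-≡ (halve (recip-inverse {2} (λ ())))
    (integral*multiple (integral-inv p∤2) (multiple-≡ (sub-sub S₂ (S₁ + S₁)) (multiple-- inverse-squares S₂≡2S₁)))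
    where
    S₂≡2S₁ : Multiple 1 (S₂ - (S₁ + S₁))
    S₂≡2S₁ = multiple-≡ (cong₂ _-_ (sym (sum-reflect h recipSq)) (sum-+ h recipSq recipSq))
      (multiple-≡ (sum-- h _ _) (multiple-sum h _ (λ k 1≤k k≤h →
        multiple-≡ (sym (cancel (recipSq k) (recipSq (p ∸ k)))) (recipSq-reflect k 1≤k k≤h))))
      where
      cancel : ∀ a b → (a + b) - (a + a) ≡ b - a
      cancel = solve-∀ ℚ-ring
    sub-sub : ∀ u s → u - (u - s) ≡ s
    sub-sub = solve-∀ ℚ-ring
    halve : recip 2 * nq 2 ≡ 1ℚ → recip 2 * (S₁ + S₁) ≡ S₁
    halve e₂ = trans (double S₁) (trans (cong (_* S₁) e₂) (*-identityˡ S₁))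
      where
      double : ∀ s → recip 2 * (s + s) ≡ (recip 2 * nq 2) * s
      double = solve-∀ ℚ-ring

  -- T = Σ_{k=1}^{h} 1/(k(p-k)), the pair sum of the harmonic number H_{p-1}.
  T : ℚ
  T = sumℚ h (λ k → recip (k ℕ.* (p ∸ k)))

  reflected-pair : ∀ k → 1 ≤ k → k ≤ h → recip k + recip (p ∸ k) ≡ nq p * recip (k ℕ.* (p ∸ k))
  reflected-pair k 1≤k k≤h = trans (recip-+ (ℕP.m<n⇒n≢0 1≤k) (∤⇒≢0 (p∤p∸k 1≤k k≤h)))
    (cong (λ n → nq n * recip (k ℕ.* (p ∸ k))) (complement′ k≤h))

  harmonic : sumℚ (h ℕ.+ h) recip ≡ nq p * T
  harmonic = begin
    sumℚ (h ℕ.+ h) recip                                ≡⟨ sum-reflect h recip ⟩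
    sumℚ h (λ k → recip k + recip (p ∸ k))              ≡⟨ sum-cong h reflected-pair ⟩
    sumℚ h (λ k → nq p * recip (k ℕ.* (p ∸ k)))         ≡⟨ sum-scale h (nq p) _ ⟩
    nq p * T ∎

  -- T ≡ -S₁ (mod p) termwise, since 1/(k(p-k)) + 1/k² = p/(k²(p-k)); hence T ≡ 0.
  T-multiple : Multiple 1 T
  T-multiple = multiple-≡ (add-sub T S₁)
    (multiple-- (multiple-≡ (sum-+ h _ recipSq) (multiple-sum h _ term)) half-inverse-squares)
    where
    term : ∀ k → 1 ≤ k → k ≤ h → Multiple 1 (recip (k ℕ.* (p ∸ k)) + recipSq k)
    term k 1≤k k≤h = multiple-≡ (sym (begin
      recip (k ℕ.* (p ∸ k)) + recipSq k
        ≡⟨ recip-+ (∤⇒≢0 p∤k[p∸k]) (∤⇒≢0 (p∤square p∤k′)) ⟩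
      nq (k ℕ.* (p ∸ k) ℕ.+ k ℕ.* k) * R
        ≡⟨ cong (λ n → nq n * R) (trans (sym (ℕP.*-distribˡ-+ k (p ∸ k) k)) (cong (k ℕ.*_) (complement k≤h))) ⟩
      nq (k ℕ.* p) * R
        ≡⟨ cong (_* R) (trans (nq-* k p) (*-comm (nq k) (nq p))) ⟩
      (nq p * nq k) * R
        ≡⟨ *-assoc (nq p) (nq k) R ⟩
      nq p * (nq k * R) ∎))
      (multiply-by-p (integral⇒multiple (integral-* (integral-nq k) (integral-inv (∤-* p∤k[p∸k] (p∤square p∤k′))))))
      where
      p∤k′ : ¬ p ∣ k
      p∤k′ = p∤k 1≤k k≤h
      p∤k[p∸k] : ¬ p ∣ (k ℕ.* (p ∸ k))
      p∤k[p∸k] = ∤-* p∤k′ (p∤p∸k 1≤k k≤h)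
      R = recip (k ℕ.* (p ∸ k) ℕ.* (k ℕ.* k))
    add-sub : ∀ t s → (t + s) - s ≡ t
    add-sub = solve-∀ ℚ-ring

  Cp : ℚ
  Cp = nq ((2 ℕ.* p) C p)

  -- (p+t)/t = 1 + p/t, so that C(2p,p) = Π_{t=1}^{p} (1 + p/t).
  factor : ℕ → ℚ
  factor t = 1ℚ + nq p * recip t

  factor-times : ∀ t → 1 ≤ t → factor t * nq t ≡ nq (p ℕ.+ t)
  factor-times t 1≤t = begin
    (1ℚ + nq p * recip t) * nq t      ≡⟨ distribute (nq p) (nq t) (recip t) ⟩
    nq p * (recip t * nq t) + nq t    ≡⟨ cong (λ z → nq p * z + nq t) (recip-inverse (ℕP.m<n⇒n≢0 1≤t)) ⟩
    nq p * 1ℚ + nq t                  ≡⟨ cong (_+ nq t) (*-identityʳ (nq p)) ⟩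
    nq p + nq t                       ≡⟨ nq-+ p t ⟨
    nq (p ℕ.+ t) ∎
    where
    distribute : ∀ P t r → (1ℚ + P * r) * t ≡ P * (r * t) + t
    distribute = solve-∀ ℚ-ring

  centralBinomial-product : Cp ≡ prodℚ p factor
  centralBinomial-product = *-cancelʳ Cp (prodℚ p factor) (prodℚ p nq) p!≢0 (begin
    Cp * prodℚ p nq                     ≡⟨ cong₂ _*_ (cong nq C≡binom) (sym (nq-factorial p)) ⟩
    nq (binom (p ℕ.+ p) p) * nq (p !)   ≡⟨ nq-* (binom (p ℕ.+ p) p) (p !) ⟨
    nq (binom (p ℕ.+ p) p ℕ.* p !)      ≡⟨ cong nq (binom-rising p p) ⟩
    nq (rising p p)                     ≡⟨ nq-rising p p ⟩
    prodℚ p (λ t → nq (p ℕ.+ t))        ≡⟨ prod-cong p (λ t 1≤t _ → sym (factor-times t 1≤t)) ⟩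
    prodℚ p (λ t → factor t * nq t)     ≡⟨ prod-* p factor nq ⟩
    prodℚ p factor * prodℚ p nq ∎)
    where
    C≡binom : (2 ℕ.* p) C p ≡ binom (p ℕ.+ p) p
    C≡binom = trans (cong (λ n → (p ℕ.+ n) C p) (ℕP.+-identityʳ p)) (sym (binom≡C (p ℕ.+ p) p))
    p!≢0 : prodℚ p nq ≢ 0ℚ
    p!≢0 p!≡0 = nq≢0 (factorial≢0 p) (trans (nq-factorial p) p!≡0)

  -- 2p², which measures the distance of each paired factor from 1.
  twoP² : ℚ
  twoP² = nq 2 * (nq p * nq p)

  y : ℕ → ℚ
  y k = twoP² * recip (k ℕ.* (p ∸ k))

  Q : ℚ
  Q = prodℚ h (λ k → 1ℚ + y k)

  factor-pair : ∀ k → 1 ≤ k → k ≤ h → factor k * factor (p ∸ k) ≡ 1ℚ + y k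
  factor-pair k 1≤k k≤h = begin
    (1ℚ + P * a) * (1ℚ + P * b)        ≡⟨ expand P a b ⟩
    1ℚ + P * (a + b) + P * P * (a * b) ≡⟨ cong₂ (λ u v → 1ℚ + P * u + P * P * v) (reflected-pair k 1≤k k≤h) (sym (recip-* k (p ∸ k))) ⟩
    1ℚ + P * (P * r) + P * P * r       ≡⟨ collect P r ⟩
    1ℚ + twoP² * r ∎
    where
    P = nq p
    a = recip k
    b = recip (p ∸ k)
    r = recip (k ℕ.* (p ∸ k))
    expand : ∀ P a b → (1ℚ + P * a) * (1ℚ + P * b) ≡ 1ℚ + P * (a + b) + P * P * (a * b)
    expand = solve-∀ ℚ-ring
    collect : ∀ P r → 1ℚ + P * (P * r) + P * P * r ≡ 1ℚ + nq 2 * (P * P) * r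
    collect = solve-∀ ℚ-ring

  -- Pairing t with p - t, and the last factor 1 + p/p = 2.
  centralBinomial≡2Q : Cp ≡ Q * nq 2
  centralBinomial≡2Q = begin
    Cp                                                  ≡⟨ centralBinomial-product ⟩
    prodℚ (h ℕ.+ h) factor * factor p                   ≡⟨ cong₂ _*_ (prod-reflect h factor) last-factor ⟩
    prodℚ h (λ k → factor k * factor (p ∸ k)) * nq 2    ≡⟨ cong (_* nq 2) (prod-cong h factor-pair) ⟩
    Q * nq 2 ∎
    where
    last-factor : factor p ≡ nq 2
    last-factor = cong (1ℚ +_) (trans (*-comm (nq p) (recip p)) (recip-inverse p≢0))

  twoP²-multiple : ∀ {m x} → Multiple m x → Multiple (2 ℕ.+ m) (twoP² * x)
  twoP²-multiple {m} {x} x∈ = multiple-≡ (regroup (nq p) x) (multiply-by-p (multiply-by-p (integral*multiple (integral-nq 2) x∈)))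
    where
    regroup : ∀ P x → P * (P * (nq 2 * x)) ≡ nq 2 * (P * P) * x
    regroup = solve-∀ ℚ-ring

  Q-expansion : Multiple 4 (Q - 1ℚ - twoP² * T)
  Q-expansion = multiple-≡ (cong (λ s → Q - 1ℚ - s) (sum-scale h twoP² _))
    (prod-expansion h y (λ k 1≤k k≤h → twoP²-multiple (integral⇒multiple (integral-inv (∤-* (p∤k 1≤k k≤h) (p∤p∸k 1≤k k≤h))))))

  private
    sub-add : ∀ a b → (a - b) + b ≡ a
    sub-add = solve-∀ ℚ-ring

  Q≡1 : Multiple 2 (Q - 1ℚ)
  Q≡1 = multiple-≡ (sub-add (Q - 1ℚ) _)
    (multiple-+ (multiple-weaken {2} {2} Q-expansion) (twoP²-multiple (integral⇒multiple (multiple⇒integral T-multiple))))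

  wolstenholme : Multiple 3 (Cp - nq 2)
  wolstenholme = multiple-≡ twice-Q-1 (integral*multiple (integral-nq 2)
    (multiple-≡ (sub-add (Q - 1ℚ) _) (multiple-+ (multiple-weaken {3} {1} Q-expansion) (twoP²-multiple T-multiple))))
    where
    distribute : ∀ q two → two * (q - 1ℚ) ≡ q * two - two
    distribute = solve-∀ ℚ-ring
    twice-Q-1 : nq 2 * (Q - 1ℚ) ≡ Cp - nq 2
    twice-Q-1 = trans (distribute Q (nq 2)) (cong (_- nq 2) (sym centralBinomial≡2Q))

  p∤centralBinomial : ¬ p ∣ ((2 ℕ.* p) C p)
  p∤centralBinomial p∣C = p∤2 (multiple⇒∣ (multiple-≡ (sub-sub Cp (nq 2)) (multiple-- (∣⇒multiple p∣C) (multiple-weaken {1} {2} wolstenholme))))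
    where
    sub-sub : ∀ c t → c - (c - t) ≡ t
    sub-sub = solve-∀ ℚ-ring

  Cp≢0 : Cp ≢ 0ℚ
  Cp≢0 = nq≢0 (∤⇒≢0 p∤centralBinomial)

module CoefficientwiseCongruence (h : ℕ) (p-prime : Prime (suc (h ℕ.+ h))) (2≤h : 2 ℕ.≤ h) where

  open import Data.Nat as ℕ using (zero; _≤_; s≤s; z≤n; _!)
  import Data.Nat.Properties as ℕP
  open import Data.Nat.Combinatorics using (_C_)
  open import Data.Nat.Divisibility using (_∣_; divides)
  open import Data.Rational using (0ℚ; 1ℚ; _+_; _*_; _-_; -_)
  open import Data.Rational.Properties using (*-identityˡ; *-identityʳ; *-zeroʳ; +-identityˡ; *-comm; *-assoc)
  open import Relation.Binary.PropositionalEquality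
  open import Relation.Nullary using (¬_; Dec; yes; no)
  open import Tactic.RingSolver using (solve-∀)
  open RationalArithmetic
  open Sums
  open Binomial using (binom; binom≡C; binom-one; factorial≢0; binom-absorb; binom-absorb-pascal; double-suc; central-binomial; lucasNum; lucasNum-diag; lucasNum-absorb; hockey-stick)
  open Products using (prodℚ; prod-*; nq-factorial)
  open Coefficients
  open LucasAtTwoMinusT
  open Wolstenholme h p-prime 2≤h
  open Local p p-prime
  open ≡-Reasoning

  lhsCoeff : ℕ → ℚ
  lhsCoeff k = nq p * inv (nq (k ℕ.^ 3) * nq ((2 ℕ.* k) C k))

  lhs-coefficient : ∀ i → lhs p i ≡ sumℚ (h ℕ.+ h) (λ k → lhsCoeff k * monomial k i)
  lhs-coefficient = sumP-coefficient (h ℕ.+ h) (λ k → lhsCoeff k · monomial k)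

  S : ℕ → ℚ
  S i = sumℚ (h ℕ.+ h) (λ k → recip k * lucas twoMinusT k i)

  rhs-coefficient : ∀ i → rhs p i ≡ (p⁻¹ * p⁻¹) * (const 1ℚ i - inv Cp * (lucas twoMinusT p i + monomial p i)) - p⁻¹ * S i
  rhs-coefficient i = cong₂ (λ u v → u * (const 1ℚ i - inv Cp * (lucas twoMinusT p i + monomial p i)) - p⁻¹ * v)
    (trans (cong recip (cong (p ℕ.*_) (ℕP.*-identityʳ p))) (recip-* p p))
    (sumP-coefficient (h ℕ.+ h) (λ k → recip k · lucas twoMinusT k) i)

  S-zero : S 0 ≡ nq 2 * (nq p * T)
  S-zero = begin
    S 0                                  ≡⟨ sum-cong (h ℕ.+ h) (λ k _ _ → trans (cong (recip k *_) (lucas-coefficient k 0)) (*-comm (recip k) (nq 2))) ⟩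
    sumℚ (h ℕ.+ h) (λ k → nq 2 * recip k) ≡⟨ sum-scale (h ℕ.+ h) (nq 2) recip ⟩
    nq 2 * sumℚ (h ℕ.+ h) recip          ≡⟨ cong (nq 2 *_) harmonic ⟩
    nq 2 * (nq p * T) ∎

  -- As a polynomial identity in
  -- ι, P, c, Q, T it holds modulo ιP = 1 and c·2Q = 1; the ring solver checks
  -- the explicit combination of these relations.
  constant-term-identity : ∀ ι P c Q T → ι * P ≡ 1ℚ → c * (Q * nq 2) ≡ 1ℚ →
    0ℚ - ((ι * ι) * (1ℚ - c * (nq 2 + 0ℚ)) - ι * (nq 2 * (P * T)))
    ≡ (nq 4 * T * c) * (Q - 1ℚ) - (nq 2 * c) * (ι * (ι * (Q - 1ℚ - (nq 2 * (P * P)) * T)))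
  constant-term-identity ι P c Q T ιP≡1 2cQ≡1 = begin
    0ℚ - ((ι * ι) * (1ℚ - c * (nq 2 + 0ℚ)) - ι * (nq 2 * (P * T)))
      ≡⟨ combination ι P c Q T ⟩
    Z + ι * ι * (c * (Q * nq 2) - 1ℚ) + nq 2 * T * (ι * P - c * (Q * nq 2)) + nq 4 * T * c * (1ℚ - (ι * P) * (ι * P))
      ≡⟨ cong₂ (λ u v → Z + ι * ι * (v - 1ℚ) + nq 2 * T * (u - v) + nq 4 * T * c * (1ℚ - u * u)) ιP≡1 2cQ≡1 ⟩
    Z + ι * ι * (1ℚ - 1ℚ) + nq 2 * T * (1ℚ - 1ℚ) + nq 4 * T * c * (1ℚ - 1ℚ * 1ℚ)
      ≡⟨ vanish Z (ι * ι) (nq 2 * T) (nq 4 * T * c) ⟩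
    Z ∎
    where
    Z = (nq 4 * T * c) * (Q - 1ℚ) - (nq 2 * c) * (ι * (ι * (Q - 1ℚ - (nq 2 * (P * P)) * T)))
    combination : ∀ ι P c Q T →
      0ℚ - ((ι * ι) * (1ℚ - c * (nq 2 + 0ℚ)) - ι * (nq 2 * (P * T)))
      ≡ ((nq 4 * T * c) * (Q - 1ℚ) - (nq 2 * c) * (ι * (ι * (Q - 1ℚ - (nq 2 * (P * P)) * T))))
        + ι * ι * (c * (Q * nq 2) - 1ℚ) + nq 2 * T * (ι * P - c * (Q * nq 2)) + nq 4 * T * c * (1ℚ - (ι * P) * (ι * P))
    combination = solve-∀ ℚ-ring
    vanish : ∀ z x y w → z + x * (1ℚ - 1ℚ) + y * (1ℚ - 1ℚ) + w * (1ℚ - 1ℚ * 1ℚ) ≡ z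
    vanish = solve-∀ ℚ-ring

  coefficient-zero : Multiple 2 (lhs p 0 - rhs p 0)
  coefficient-zero = multiple-≡ (sym difference)
    (multiple-- (integral*multiple (integral-* (integral-* (integral-nq 4) (multiple⇒integral T-multiple)) (integral-inv p∤centralBinomial)) Q≡1)
                (integral*multiple (integral-* (integral-nq 2) (integral-inv p∤centralBinomial)) (divide-by-p (divide-by-p Q-expansion))))
    where
    lhs₀ : lhs p 0 ≡ 0ℚ
    lhs₀ = trans (lhs-coefficient 0) (monomial-sum-outside (h ℕ.+ h) lhsCoeff 0 (λ { (suc k) _ _ () }))
    rhs₀ : rhs p 0 ≡ (p⁻¹ * p⁻¹) * (1ℚ - inv Cp * (nq 2 + 0ℚ)) - p⁻¹ * (nq 2 * (nq p * T))
    rhs₀ = trans (rhs-coefficient 0) (cong₂ (λ u v → (p⁻¹ * p⁻¹) * (1ℚ - inv Cp * u) - p⁻¹ * v)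
      (cong₂ _+_ (lucas-coefficient p 0) (monomial-other p 0 (λ ()))) S-zero)
    difference : lhs p 0 - rhs p 0 ≡ (nq 4 * T * inv Cp) * (Q - 1ℚ) - (nq 2 * inv Cp) * (p⁻¹ * (p⁻¹ * (Q - 1ℚ - twoP² * T)))
    difference = trans (cong₂ _-_ lhs₀ rhs₀) (constant-term-identity p⁻¹ (nq p) (inv Cp) Q T p⁻¹*p
      (trans (cong (inv Cp *_) (sym centralBinomial≡2Q)) (inv-inverseˡ Cp Cp≢0)))

  -- Coefficients of t^i for i ≥ p: the left side has none, and on the right
  -- only t^p occurs, where v_p(2-t) contributes (-1)^p t^p = -t^p.
  coefficient-high : ∀ i → p ≤ i → Multiple 2 (lhs p i - rhs p i)
  coefficient-high (suc i) p≤i = multiple-≡ (sym (trans (cong₂ _-_ lhsᵢ rhsᵢ) (vanish (p⁻¹ * p⁻¹) (inv Cp) p⁻¹))) multiple-0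
    where
    k<i : ∀ {k} → k ≤ h ℕ.+ h → k ℕ.< suc i
    k<i k≤2h = ℕP.<-≤-trans (s≤s k≤2h) p≤i
    lhsᵢ : lhs p (suc i) ≡ 0ℚ
    lhsᵢ = trans (lhs-coefficient (suc i)) (monomial-sum-outside (h ℕ.+ h) lhsCoeff (suc i) (λ k _ k≤2h k≡i → ℕP.<-irrefl k≡i (k<i k≤2h)))
    Sᵢ : S (suc i) ≡ 0ℚ
    Sᵢ = sum-vanish (h ℕ.+ h) _ (λ k _ k≤2h → trans (cong (recip k *_) (trans (lucas-coefficient k (suc i)) (lucasCoeff-vanish k (suc i) (k<i k≤2h)))) (*-zeroʳ (recip k)))
    sign-p : sign p ≡ - 1ℚ
    sign-p = cong -_ (sign-even h)
      where
      sign-even : ∀ n → sign (n ℕ.+ n) ≡ 1ℚ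
      sign-even zero = refl
      sign-even (suc n) = trans (cong (λ m → - sign m) (ℕP.+-suc n n)) (trans (double-neg (sign (n ℕ.+ n))) (sign-even n))
        where
        double-neg : ∀ x → - (- x) ≡ x
        double-neg = solve-∀ ℚ-ring
    top : lucas twoMinusT p (suc i) + monomial p (suc i) ≡ 0ℚ
    top = by-cases (p ℕ.≟ suc i)
      where
      by-cases : Dec (p ≡ suc i) → lucas twoMinusT p (suc i) + monomial p (suc i) ≡ 0ℚ
      by-cases (yes refl) = begin
        lucas twoMinusT p p + monomial p p  ≡⟨ cong₂ _+_ (lucas-coefficient p p) (monomial-same p) ⟩
        sign p * nq (lucasNum p p) + 1ℚ    ≡⟨ cong₂ (λ s n → s * nq n + 1ℚ) sign-p (lucasNum-diag (h ℕ.+ h)) ⟩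
        - 1ℚ * nq 1 + 1ℚ                   ≡⟨⟩
        0ℚ ∎
      by-cases (no p≢i) = trans (cong₂ _+_ (trans (lucas-coefficient p (suc i)) (lucasCoeff-vanish p (suc i) (ℕP.≤∧≢⇒< p≤i p≢i)))
                                          (monomial-other p (suc i) p≢i)) (+-identityˡ 0ℚ)
    rhsᵢ : rhs p (suc i) ≡ (p⁻¹ * p⁻¹) * (0ℚ - inv Cp * 0ℚ) - p⁻¹ * 0ℚ
    rhsᵢ = trans (rhs-coefficient (suc i)) (cong₂ (λ u v → (p⁻¹ * p⁻¹) * (0ℚ - inv Cp * u) - p⁻¹ * v) top Sᵢ)
    vanish : ∀ a b c → 0ℚ - (a * (0ℚ - b * 0ℚ) - c * 0ℚ) ≡ 0ℚ
    vanish = solve-∀ ℚ-ring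

  -- p/n! ∈ ℤ_(p) for n < 2p, since such n! contains the prime p at most once.
  p∤factorial : ∀ n → n < p → ¬ p ∣ n !
  p∤factorial zero _ = p∤1
  p∤factorial (suc n) n<p = ∤-* (p∤small (suc n) (s≤s z≤n) n<p) (p∤factorial n (ℕP.<-trans (ℕP.n<1+n n) n<p))

  p∤below-2p : ∀ m → 1 ≤ m → m < p ℕ.+ p → m ≢ p → ¬ p ∣ m
  p∤below-2p _ () _ _ (divides zero refl)
  p∤below-2p _ _ _ m≢p (divides (suc zero) refl) = m≢p (ℕP.+-identityʳ p)
  p∤below-2p _ _ m<2p _ (divides (suc (suc q)) refl) =
    ℕP.<-irrefl refl (ℕP.<-≤-trans m<2p (ℕP.+-monoʳ-≤ p (ℕP.m≤m+n p (q ℕ.* p))))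

  p/factorial : ∀ n → n < p ℕ.+ p → Integral (nq p * recip (n !))
  p/factorial zero _ = integral-* (integral-nq p) (integral-inv p∤1)
  p/factorial (suc n) n<2p with suc n ℕ.≟ p
  ... | yes refl = subst Integral (sym cancel-p) (integral-inv (p∤factorial n (ℕP.n<1+n n)))
    where
    cancel-p : nq p * recip (p ℕ.* n !) ≡ recip (n !)
    cancel-p = begin
      nq p * recip (p ℕ.* n !)          ≡⟨ cong (nq p *_) (recip-* p (n !)) ⟩
      nq p * (recip p * recip (n !))    ≡⟨ *-assoc (nq p) (recip p) (recip (n !)) ⟨
      (nq p * recip p) * recip (n !)    ≡⟨ cong (_* recip (n !)) (trans (*-comm (nq p) (recip p)) p⁻¹*p) ⟩
      1ℚ * recip (n !)                  ≡⟨ *-identityˡ _ ⟩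
      recip (n !) ∎
  ... | no n+1≢p = subst Integral (sym peel) (integral-* (integral-inv (p∤below-2p (suc n) (s≤s z≤n) n<2p n+1≢p))
                                                         (p/factorial n (ℕP.<-trans (ℕP.n<1+n n) n<2p)))
    where
    peel : nq p * recip (suc n ℕ.* n !) ≡ recip (suc n) * (nq p * recip (n !))
    peel = trans (cong (nq p *_) (recip-* (suc n) (n !))) (swap (nq p) (recip (suc n)) (recip (n !)))
      where
      swap : ∀ x y z → x * (y * z) ≡ y * (x * z)
      swap = solve-∀ ℚ-ring

  -- For the coefficient of t^i with i = j+1 ≤ p-1 we use
  -- A_j = C(p+j, 2j+1), B_j = C(p+j, 2j+2) and E_j = Π_{t=1}^{j} (t² - p²).
  A B : ℕ → ℕ
  A j = binom (p ℕ.+ j) (suc (j ℕ.+ j))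
  B j = binom (p ℕ.+ j) (suc (suc (j ℕ.+ j)))

  E : ℕ → ℚ
  E j = prodℚ j (λ t → nq t * nq t - nq p * nq p)

  oddFactorial : ℕ → ℕ
  oddFactorial j = suc (j ℕ.+ j) !

  nq-2i : ∀ j → nq (suc (suc (j ℕ.+ j))) ≡ nq (suc j) + nq (suc j)
  nq-2i j = trans (cong nq (sym (double-suc j))) (nq-+ (suc j) (suc j))

  nq-p+i : ∀ j → nq (suc (p ℕ.+ j)) ≡ nq p + nq (suc j)
  nq-p+i j = trans (cong nq (sym (ℕP.+-suc p j))) (nq-+ p (suc j))

  B-from-A : ∀ j → nq (suc (suc (j ℕ.+ j))) * nq (B j) ≡ (nq p - nq (suc j)) * nq (A j)
  B-from-A j = isolate (e * b) e a (nq p) (nq (suc j)) (nq-2i j) (begin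
    e * b + e * a                   ≡⟨ cong₂ _+_ (nq-* e′ (B j)) (nq-* e′ (A j)) ⟨
    nq (e′ ℕ.* B j) + nq (e′ ℕ.* A j) ≡⟨ nq-+ (e′ ℕ.* B j) (e′ ℕ.* A j) ⟨
    nq (e′ ℕ.* B j ℕ.+ e′ ℕ.* A j)  ≡⟨ cong nq (binom-absorb-pascal (p ℕ.+ j) (suc (j ℕ.+ j))) ⟩
    nq (suc (p ℕ.+ j) ℕ.* A j)      ≡⟨ nq-* (suc (p ℕ.+ j)) (A j) ⟩
    nq (suc (p ℕ.+ j)) * a          ≡⟨ cong (_* a) (nq-p+i j) ⟩
    (nq p + nq (suc j)) * a ∎)
    where
    e′ = suc (suc (j ℕ.+ j))
    e = nq e′
    a = nq (A j)
    b = nq (B j)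
    isolate : ∀ x e a P i → e ≡ i + i → x + e * a ≡ (P + i) * a → x ≡ (P - i) * a
    isolate x e a P i e≡2i x+ea≡ = begin
      x                      ≡⟨ add-sub x (e * a) ⟩
      (x + e * a) - e * a    ≡⟨ cong₂ (λ u v → u - v * a) x+ea≡ e≡2i ⟩
      (P + i) * a - (i + i) * a ≡⟨ collect P i a ⟩
      (P - i) * a ∎
      where
      add-sub : ∀ x y → x ≡ (x + y) - y
      add-sub = solve-∀ ℚ-ring
      collect : ∀ P i a → (P + i) * a - (i + i) * a ≡ (P - i) * a
      collect = solve-∀ ℚ-ring

  A-step : ∀ j → nq (suc (suc (suc (j ℕ.+ j)))) * nq (A (suc j)) ≡ (nq p + nq (suc j)) * nq (B j)
  A-step j = begin
    nq o * nq (A (suc j))                 ≡⟨ cong (λ n → nq o * nq n) (cong₂ binom (ℕP.+-suc p j) (cong suc (double-suc j))) ⟩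
    nq o * nq (binom (suc (p ℕ.+ j)) o)   ≡⟨ nq-* o (binom (suc (p ℕ.+ j)) o) ⟨
    nq (o ℕ.* binom (suc (p ℕ.+ j)) o)    ≡⟨ cong nq (binom-absorb (p ℕ.+ j) (suc (suc (j ℕ.+ j)))) ⟩
    nq (suc (p ℕ.+ j) ℕ.* B j)            ≡⟨ nq-* (suc (p ℕ.+ j)) (B j) ⟩
    nq (suc (p ℕ.+ j)) * nq (B j)         ≡⟨ cong (_* nq (B j)) (nq-p+i j) ⟩
    (nq p + nq (suc j)) * nq (B j) ∎
    where
    o = suc (suc (suc (j ℕ.+ j)))

  oddFactorial-step : ∀ j → nq (oddFactorial (suc j)) ≡ nq (suc (suc (suc (j ℕ.+ j)))) * (nq (suc (suc (j ℕ.+ j))) * nq (oddFactorial j))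
  oddFactorial-step j = begin
    nq (suc (suc j ℕ.+ suc j) !)          ≡⟨ cong (λ n → nq (suc n !)) (double-suc j) ⟩
    nq (o ℕ.* (e ℕ.* oddFactorial j))     ≡⟨ nq-* o (e ℕ.* oddFactorial j) ⟩
    nq o * nq (e ℕ.* oddFactorial j)      ≡⟨ cong (nq o *_) (nq-* e (oddFactorial j)) ⟩
    nq o * (nq e * nq (oddFactorial j)) ∎
    where
    o = suc (suc (suc (j ℕ.+ j)))
    e = suc (suc (j ℕ.+ j))

  signed-A : ∀ j → nq (oddFactorial j) * (sign j * nq (A j)) ≡ nq p * E j
  signed-A zero = trans (cong (λ n → 1ℚ * (1ℚ * nq n)) (trans (binom-one (p ℕ.+ 0)) (ℕP.+-identityʳ p))) (units (nq p))
    where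
    units : ∀ x → 1ℚ * (1ℚ * x) ≡ x * 1ℚ
    units = solve-∀ ℚ-ring
  signed-A (suc j) = begin
    nq (oddFactorial (suc j)) * ((- s) * a′)        ≡⟨ cong (_* ((- s) * a′)) (oddFactorial-step j) ⟩
    (o * (e * X)) * ((- s) * a′)                    ≡⟨ regroup₁ o e X s a′ ⟩
    (- s) * X * e * (o * a′)                        ≡⟨ cong ((- s) * X * e *_) (A-step j) ⟩
    (- s) * X * e * ((P + i) * b)                   ≡⟨ regroup₂ s X e P i b ⟩
    (- s) * X * (P + i) * (e * b)                   ≡⟨ cong ((- s) * X * (P + i) *_) (B-from-A j) ⟩
    (- s) * X * (P + i) * ((P - i) * a)             ≡⟨ regroup₃ s X P i a ⟩
    (i * i - P * P) * (X * (s * a))                 ≡⟨ cong ((i * i - P * P) *_) (signed-A j) ⟩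
    (i * i - P * P) * (P * E j)                     ≡⟨ regroup₄ i P (E j) ⟩
    P * (E j * (i * i - P * P)) ∎
    where
    s = sign j
    a = nq (A j)
    a′ = nq (A (suc j))
    b = nq (B j)
    X = nq (oddFactorial j)
    P = nq p
    i = nq (suc j)
    o = nq (suc (suc (suc (j ℕ.+ j))))
    e = nq (suc (suc (j ℕ.+ j)))
    regroup₁ : ∀ o e X s a′ → (o * (e * X)) * ((- s) * a′) ≡ (- s) * X * e * (o * a′)
    regroup₁ = solve-∀ ℚ-ring
    regroup₂ : ∀ s X e P i b → (- s) * X * e * ((P + i) * b) ≡ (- s) * X * (P + i) * (e * b)
    regroup₂ = solve-∀ ℚ-ring
    regroup₃ : ∀ s X P i a → (- s) * X * (P + i) * ((P - i) * a) ≡ (i * i - P * P) * (X * (s * a))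
    regroup₃ = solve-∀ ℚ-ring
    regroup₄ : ∀ i P E → (i * i - P * P) * (P * E) ≡ P * (E * (i * i - P * P))
    regroup₄ = solve-∀ ℚ-ring

  -- The left-hand coefficient: p/(i³ C(2i,i)) = p (j!)² / (2 i² (2j+1)!),
  -- from C(2i,i) (i!)² = (2i)! = 2i (2j+1)!.
  lhs-middle : ∀ j → lhsCoeff (suc j) ≡ nq p * (recip (suc j) * recip (suc j) * recip 2 * (nq (j !) * nq (j !)) * recip (oddFactorial j))
  lhs-middle j = cong (nq p *_) (inv-unique (nq (suc j ℕ.^ 3) * nq Cᵢ) G (begin
    (nq (suc j ℕ.^ 3) * nq Cᵢ) * G               ≡⟨ cong (λ z → (z * nq Cᵢ) * G) cube ⟩
    ((i * (i * (i * 1ℚ))) * nq Cᵢ) * G          ≡⟨ regroup₁ i u h₂ f ξ (nq Cᵢ) ⟩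
    (nq Cᵢ * ((i * f) * (i * f))) * (i * u * u * h₂ * ξ) ≡⟨ cong (_* (i * u * u * h₂ * ξ)) central ⟩
    (e * X) * (i * u * u * h₂ * ξ)             ≡⟨ cong (λ z → (z * X) * (i * u * u * h₂ * ξ)) (nq-2i j) ⟩
    ((i + i) * X) * (i * u * u * h₂ * ξ)       ≡⟨ regroup₂ i u h₂ X ξ ⟩
    (u * i) * (u * i) * (h₂ * nq 2) * (ξ * X)  ≡⟨ cong₂ (λ a b → a * a * b * (ξ * X)) (recip-inverse {suc j} (λ ())) (recip-inverse {2} (λ ())) ⟩
    1ℚ * 1ℚ * 1ℚ * (ξ * X)                     ≡⟨ cong (1ℚ * 1ℚ * 1ℚ *_) (recip-inverse (factorial≢0 (suc (j ℕ.+ j)))) ⟩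
    1ℚ ∎))
    where
    Cᵢ = (2 ℕ.* suc j) C (suc j)
    i = nq (suc j)
    u = recip (suc j)
    h₂ = recip 2
    f = nq (j !)
    e = nq (suc (suc (j ℕ.+ j)))
    X = nq (oddFactorial j)
    ξ = recip (oddFactorial j)
    G = u * u * h₂ * (f * f) * ξ
    cube : nq (suc j ℕ.^ 3) ≡ i * (i * (i * 1ℚ))
    cube = trans (nq-* (suc j) (suc j ℕ.* (suc j ℕ.* 1))) (cong (i *_) (trans (nq-* (suc j) (suc j ℕ.* 1)) (cong (i *_) (nq-* (suc j) 1))))
    central : nq Cᵢ * ((i * f) * (i * f)) ≡ e * X
    central = begin
      nq Cᵢ * ((i * f) * (i * f))        ≡⟨ cong₂ (λ c z → nq c * (z * z)) (trans (cong (λ n → (suc j ℕ.+ n) C (suc j)) (ℕP.+-identityʳ (suc j))) (sym (binom≡C (suc j ℕ.+ suc j) (suc j)))) (sym (nq-* (suc j) (j !))) ⟩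
      nq b * (nq (suc j !) * nq (suc j !)) ≡⟨ trans (cong (nq b *_) (sym (nq-* (suc j !) (suc j !)))) (sym (nq-* b (suc j ! ℕ.* suc j !))) ⟩
      nq (b ℕ.* (suc j ! ℕ.* suc j !))   ≡⟨ cong nq (central-binomial (suc j)) ⟩
      nq ((suc j ℕ.+ suc j) !)           ≡⟨ cong (λ n → nq (n !)) (double-suc j) ⟩
      nq (suc (suc (j ℕ.+ j)) ℕ.* oddFactorial j) ≡⟨ nq-* (suc (suc (j ℕ.+ j))) (oddFactorial j) ⟩
      e * X ∎
      where
      b = binom (suc j ℕ.+ suc j) (suc j)
    regroup₁ : ∀ i u h₂ f ξ c → ((i * (i * (i * 1ℚ))) * c) * (u * u * h₂ * (f * f) * ξ) ≡ (c * ((i * f) * (i * f))) * (i * u * u * h₂ * ξ)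
    regroup₁ = solve-∀ ℚ-ring
    regroup₂ : ∀ i u h₂ X ξ → ((i + i) * X) * (i * u * u * h₂ * ξ) ≡ (u * i) * (u * i) * (h₂ * nq 2) * (ξ * X)
    regroup₂ = solve-∀ ℚ-ring

  -- [t^i] v_k(2-t)/k = (-1)^i C(k+j, 2j+1)/i, so by the hockey stick identity
  -- S_i = (-1)^i B_j / i.
  S-middle : ∀ j → S (suc j) ≡ sign (suc j) * (recip (suc j) * nq (B j))
  S-middle j = begin
    S (suc j)                                              ≡⟨ sum-cong (h ℕ.+ h) term ⟩
    sumℚ (h ℕ.+ h) (λ k → σ * (u * nq (β k)))             ≡⟨ sum-scale (h ℕ.+ h) σ _ ⟩
    σ * sumℚ (h ℕ.+ h) (λ k → u * nq (β k))               ≡⟨ cong (σ *_) (sum-scale (h ℕ.+ h) u _) ⟩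
    σ * (u * sumℚ (h ℕ.+ h) (λ k → nq (β k)))             ≡⟨ cong (λ z → σ * (u * z)) (trans (sum-nq (h ℕ.+ h) β) (cong nq (hockey-stick (h ℕ.+ h) j (suc (j ℕ.+ j)) (s≤s (ℕP.m≤m+n j j))))) ⟩
    σ * (u * nq (B j)) ∎
    where
    σ = sign (suc j)
    u = recip (suc j)
    β : ℕ → ℕ
    β k = binom (k ℕ.+ j) (suc (j ℕ.+ j))
    term : ∀ k → 1 ≤ k → k ≤ h ℕ.+ h → recip k * lucas twoMinusT k (suc j) ≡ σ * (u * nq (β k))
    term k 1≤k _ = begin
      recip k * lucas twoMinusT k (suc j)        ≡⟨ cong (recip k *_) (lucas-coefficient k (suc j)) ⟩
      recip k * (σ * nq (lucasNum k (suc j)))    ≡⟨ cong (λ z → recip k * (σ * z)) (solve-for {suc j} _ _ (λ ()) absorb) ⟩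
      recip k * (σ * (u * (nq k * nq (β k))))    ≡⟨ regroup (recip k) σ u (nq k) (nq (β k)) ⟩
      σ * (u * nq (β k)) * (recip k * nq k)      ≡⟨ cong (σ * (u * nq (β k)) *_) (recip-inverse (ℕP.m<n⇒n≢0 1≤k)) ⟩
      σ * (u * nq (β k)) * 1ℚ                    ≡⟨ *-identityʳ _ ⟩
      σ * (u * nq (β k)) ∎
      where
      absorb : nq (suc j) * nq (lucasNum k (suc j)) ≡ nq k * nq (β k)
      absorb = trans (sym (nq-* (suc j) (lucasNum k (suc j)))) (trans (cong nq (lucasNum-absorb k j)) (nq-* k (β k)))
      regroup : ∀ r σ u x y → r * (σ * (u * (x * y))) ≡ σ * (u * y) * (r * x)
      regroup = solve-∀ ℚ-ring

  lucasNum-p : ∀ j → nq (lucasNum p (suc j)) ≡ recip (suc j) * (nq p * nq (A j))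
  lucasNum-p j = solve-for {suc j} _ _ (λ ()) (trans (sym (nq-* (suc j) (lucasNum p (suc j)))) (trans (cong nq (lucasNum-absorb p j)) (nq-* p (A j))))

  -- Multiplying (2j+2) B_j = (p - i) A_j by (-1)^j / (2i).
  signed-B : ∀ j → sign j * nq (B j) ≡ (nq p - nq (suc j)) * (sign j * nq (A j)) * recip (suc j) * recip 2
  signed-B j = sym (begin
    (P - i) * (s * a) * u * h₂       ≡⟨ regroup₁ P i s a u h₂ ⟩
    s * u * h₂ * ((P - i) * a)       ≡⟨ cong (s * u * h₂ *_) (B-from-A j) ⟨
    s * u * h₂ * (e * b)             ≡⟨ cong (λ z → s * u * h₂ * (z * b)) (nq-2i j) ⟩
    s * u * h₂ * ((i + i) * b)       ≡⟨ regroup₂ s u h₂ i b ⟩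
    (u * i) * (h₂ * nq 2) * (s * b)  ≡⟨ cong₂ (λ x y → x * y * (s * b)) (recip-inverse {suc j} (λ ())) (recip-inverse {2} (λ ())) ⟩
    1ℚ * 1ℚ * (s * b)                ≡⟨ *-identityˡ (s * b) ⟩
    s * b ∎)
    where
    P = nq p
    i = nq (suc j)
    s = sign j
    a = nq (A j)
    b = nq (B j)
    e = nq (suc (suc (j ℕ.+ j)))
    u = recip (suc j)
    h₂ = recip 2
    regroup₁ : ∀ P i s a u h₂ → (P - i) * (s * a) * u * h₂ ≡ s * u * h₂ * ((P - i) * a)
    regroup₁ = solve-∀ ℚ-ring
    regroup₂ : ∀ s u h₂ i b → s * u * h₂ * ((i + i) * b) ≡ (u * i) * (h₂ * nq 2) * (s * b)
    regroup₂ = solve-∀ ℚ-ring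

  -- The identity behind the coefficients of t^i, 1 ≤ i ≤ p-1. After the
  -- substitutions (-1)^j A_j = p E_j / (2j+1)! and (-1)^j B_j from signed-B,
  -- it holds modulo ιP = 1, ui = 1, cC = 1 and h₂·2 = 1.
  middle-identity : ∀ P ι i u ξ c Γ h₂ E F s a b →
    ι * P ≡ 1ℚ → u * i ≡ 1ℚ → c * Γ ≡ 1ℚ → h₂ * nq 2 ≡ 1ℚ →
    s * a ≡ ξ * (P * E) → s * b ≡ (P - i) * (s * a) * u * h₂ →
    P * (u * u * h₂ * F * ξ) - ((ι * ι) * (0ℚ - c * ((- s) * (u * (P * a)) + 0ℚ)) - ι * ((- s) * (u * b)))
    ≡ (P * ξ) * (u * u * h₂ * (F - E) + u * E * c * h₂ * (ι * (Γ - nq 2)))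
  middle-identity P ι i u ξ c Γ h₂ E F s a b ιP≡1 ui≡1 cC≡1 2h₂≡1 sa≡ sb≡ = begin
    P * (u * u * h₂ * F * ξ) - ((ι * ι) * (0ℚ - c * ((- s) * (u * (P * a)) + 0ℚ)) - ι * ((- s) * (u * b)))
      ≡⟨ collect-signs P ι u ξ c h₂ F s a b ⟩
    P * (u * u * h₂ * F * ξ) - ι * ι * c * u * P * (s * a) - ι * u * (s * b)
      ≡⟨ cong (λ z → P * (u * u * h₂ * F * ξ) - ι * ι * c * u * P * (s * a) - ι * u * z) sb≡ ⟩
    P * (u * u * h₂ * F * ξ) - ι * ι * c * u * P * (s * a) - ι * u * ((P - i) * (s * a) * u * h₂)
      ≡⟨ cong (λ σ → P * (u * u * h₂ * F * ξ) - ι * ι * c * u * P * σ - ι * u * ((P - i) * σ * u * h₂)) sa≡ ⟩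
    P * (u * u * h₂ * F * ξ) - ι * ι * c * u * P * σ₀ - ι * u * ((P - i) * σ₀ * u * h₂)
      ≡⟨ combination P ι i u ξ c Γ h₂ E F ⟩
    Z + (1ℚ - ι * P) * K₁ + (ι * P) * K₂ * (u * i - c * Γ) + (ι * P) * K₃ * (h₂ * nq 2 - ι * P)
      ≡⟨ cong₂ (λ w v → Z + (1ℚ - w) * K₁ + w * K₂ * v + w * K₃ * (h₂ * nq 2 - w)) ιP≡1 (cong₂ _-_ ui≡1 cC≡1) ⟩
    Z + (1ℚ - 1ℚ) * K₁ + 1ℚ * K₂ * (1ℚ - 1ℚ) + 1ℚ * K₃ * (h₂ * nq 2 - 1ℚ)
      ≡⟨ cong (λ v → Z + (1ℚ - 1ℚ) * K₁ + 1ℚ * K₂ * (1ℚ - 1ℚ) + 1ℚ * K₃ * (v - 1ℚ)) 2h₂≡1 ⟩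
    Z + (1ℚ - 1ℚ) * K₁ + 1ℚ * K₂ * (1ℚ - 1ℚ) + 1ℚ * K₃ * (1ℚ - 1ℚ)
      ≡⟨ vanish Z K₁ K₂ K₃ ⟩
    Z ∎
    where
    σ₀ = ξ * (P * E)
    Z = (P * ξ) * (u * u * h₂ * (F - E) + u * E * c * h₂ * (ι * (Γ - nq 2)))
    K₁ = P * ξ * u * u * h₂ * E
    K₂ = u * h₂ * ξ * E
    K₃ = c * u * ξ * E
    collect-signs : ∀ P ι u ξ c h₂ F s a b →
      P * (u * u * h₂ * F * ξ) - ((ι * ι) * (0ℚ - c * ((- s) * (u * (P * a)) + 0ℚ)) - ι * ((- s) * (u * b)))
      ≡ P * (u * u * h₂ * F * ξ) - ι * ι * c * u * P * (s * a) - ι * u * (s * b)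
    collect-signs = solve-∀ ℚ-ring
    combination : ∀ P ι i u ξ c Γ h₂ E F →
      P * (u * u * h₂ * F * ξ) - ι * ι * c * u * P * (ξ * (P * E)) - ι * u * ((P - i) * (ξ * (P * E)) * u * h₂)
      ≡ (P * ξ) * (u * u * h₂ * (F - E) + u * E * c * h₂ * (ι * (Γ - nq 2)))
        + (1ℚ - ι * P) * (P * ξ * u * u * h₂ * E) + (ι * P) * (u * h₂ * ξ * E) * (u * i - c * Γ)
        + (ι * P) * (c * u * ξ * E) * (h₂ * nq 2 - ι * P)
    combination = solve-∀ ℚ-ring
    vanish : ∀ z x y w → z + (1ℚ - 1ℚ) * x + 1ℚ * y * (1ℚ - 1ℚ) + 1ℚ * w * (1ℚ - 1ℚ) ≡ z
    vanish = solve-∀ ℚ-ring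

  square-integral : ∀ t → Integral (nq t * nq t)
  square-integral t = integral-* (integral-nq t) (integral-nq t)

  E-integral : ∀ j → Integral (E j)
  E-integral j = integral-prod j _ (λ t _ _ → integral-- (square-integral t) (square-integral p))

  factorial-square≡E : ∀ j → Multiple 2 (nq (j !) * nq (j !) - E j)
  factorial-square≡E j = multiple-≡ (cong (_- E j) (trans (prod-* j nq nq) (sym (cong₂ _*_ (nq-factorial j) (nq-factorial j)))))
    (prod-congruence j (λ t → nq t * nq t) (λ t → nq t * nq t - P²)
      (λ t _ _ → square-integral t) (λ t _ _ → integral-- (square-integral t) (square-integral p))
      (λ t _ _ → multiple-≡ (sym (sub-sub (nq t * nq t) P²)) P²-multiple))
    where
    P² = nq p * nq p
    P²-multiple : Multiple 2 P²
    P²-multiple = multiple-≡ (cong (nq p *_) (*-identityʳ (nq p))) (multiply-by-p (multiply-by-p (integral⇒multiple (integral-nq 1))))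
    sub-sub : ∀ x y → x - (x - y) ≡ y
    sub-sub = solve-∀ ℚ-ring

  coefficient-middle : ∀ j → suc j ≤ h ℕ.+ h → Multiple 2 (lhs p (suc j) - rhs p (suc j))
  coefficient-middle j i≤2h = multiple-≡ (sym difference)
    (integral*multiple (p/factorial (suc (j ℕ.+ j)) odd<2p)
      (multiple-+ (integral*multiple (integral-* (integral-* u-integral u-integral) h₂-integral) (factorial-square≡E j))
                  (integral*multiple (integral-* (integral-* (integral-* u-integral (E-integral j)) (integral-inv p∤centralBinomial)) h₂-integral)
                                     (divide-by-p wolstenholme))))
    where
    i = suc j
    P = nq p
    u = recip i
    h₂ = recip 2
    ξ = recip (oddFactorial j)
    F = nq (j !) * nq (j !)
    i<p : i < p
    i<p = s≤s i≤2h
    u-integral : Integral u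
    u-integral = integral-inv (p∤small i (s≤s z≤n) i<p)
    h₂-integral : Integral h₂
    h₂-integral = integral-inv p∤2
    odd<2p : suc (j ℕ.+ j) < p ℕ.+ p
    odd<2p = s≤s (ℕP.≤-trans (ℕP.+-mono-≤ i≤2h (ℕP.≤-trans (ℕP.n≤1+n j) i≤2h)) (ℕP.+-monoʳ-≤ (h ℕ.+ h) (ℕP.n≤1+n (h ℕ.+ h))))
    lhsᵢ : lhs p i ≡ P * (u * u * h₂ * F * ξ)
    lhsᵢ = trans (lhs-coefficient i) (trans (monomial-sum-inside (h ℕ.+ h) lhsCoeff i (s≤s z≤n) i≤2h) (lhs-middle j))
    rhsᵢ : rhs p i ≡ (p⁻¹ * p⁻¹) * (0ℚ - inv Cp * ((- sign j) * (u * (P * nq (A j))) + 0ℚ)) - p⁻¹ * ((- sign j) * (u * nq (B j)))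
    rhsᵢ = trans (rhs-coefficient i) (cong₂ (λ x y → (p⁻¹ * p⁻¹) * (0ℚ - inv Cp * x) - p⁻¹ * y)
      (cong₂ _+_ (trans (lucas-coefficient p i) (cong (sign i *_) (lucasNum-p j))) (monomial-other p i (λ p≡i → ℕP.<-irrefl (sym p≡i) i<p)))
      (S-middle j))
    difference : lhs p i - rhs p i ≡ (P * ξ) * (u * u * h₂ * (F - E j) + u * E j * inv Cp * h₂ * (p⁻¹ * (Cp - nq 2)))
    difference = trans (cong₂ _-_ lhsᵢ rhsᵢ) (middle-identity P p⁻¹ (nq i) u ξ (inv Cp) Cp h₂ (E j) F (sign j) (nq (A j)) (nq (B j))
      p⁻¹*p (recip-inverse {i} (λ ())) (inv-inverseˡ Cp Cp≢0) (recip-inverse {2} (λ ()))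
      (solve-for {oddFactorial j} _ _ (factorial≢0 (suc (j ℕ.+ j))) (signed-A j)) (signed-B j))

  coefficientwise : ∀ i → Multiple 2 (lhs p i - rhs p i)
  coefficientwise zero = coefficient-zero
  coefficientwise (suc j) = by-range (suc j ℕ.≤? h ℕ.+ h)
    where
    by-range : Dec (suc j ≤ h ℕ.+ h) → Multiple 2 (lhs p (suc j) - rhs p (suc j))
    by-range (yes i≤2h) = coefficient-middle j i≤2h
    by-range (no i≰2h) = coefficient-high (suc j) (ℕP.≰⇒> i≰2h)

  congruence : lhs p ≡ rhs p [modP p ^ 2 ]
  congruence i = multiple⇒InPowZp (coefficientwise i)

module OddPrime where

  open import Data.Nat using (zero; _+_; _≤_; _≤?_; s≤s; z≤n)
  import Data.Nat.Properties as ℕP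
  open import Data.Nat.Divisibility using (divides)
  open import Data.Nat.Primality using (prime⇒irreducible)
  open import Data.Product using (Σ; _×_; _,_)
  open import Data.Sum using (_⊎_; inj₁; inj₂)
  open import Data.Empty using (⊥-elim)
  open import Relation.Nullary using (yes; no)
  open import Relation.Binary.PropositionalEquality using (refl; sym; trans; cong)

  parity : ∀ n → Σ ℕ (λ q → n ≡ q + q ⊎ n ≡ suc (q + q))
  parity zero = 0 , inj₁ refl
  parity (suc n) with parity n
  ... | q , inj₁ n≡2q = q , inj₂ (cong suc n≡2q)
  ... | q , inj₂ n≡2q+1 = suc q , inj₁ (cong suc (trans n≡2q+1 (sym (ℕP.+-suc q q))))

  odd-prime : ∀ p → Prime p → 3 < p → Σ ℕ (λ h → p ≡ suc (h + h) × 2 ≤ h)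
  odd-prime p p-prime 3<p with parity p
  ... | q , inj₁ p≡2q with prime⇒irreducible p-prime (divides q (trans p≡2q (trans (cong (q +_) (sym (ℕP.+-identityʳ q))) (ℕP.*-comm 2 q))))
  ...   | inj₁ ()
  ...   | inj₂ 2≡p = ⊥-elim (ℕP.<-irrefl 2≡p (ℕP.<-trans (s≤s (s≤s (s≤s z≤n))) 3<p))
  odd-prime p p-prime 3<p | q , inj₂ p≡2q+1 with 2 ≤? q
  ...   | yes 2≤q = q , p≡2q+1 , 2≤q
  ...   | no 2≰q = ⊥-elim (ℕP.<-irrefl refl (ℕP.<-≤-trans 3<p (ℕP.≤-trans (ℕP.≤-reflexive p≡2q+1) (s≤s (ℕP.+-mono-≤ q≤1 q≤1)))))
    where
    q≤1 : q ≤ 1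
    q≤1 = ℕP.≤-pred (ℕP.≰⇒> 2≰q)

theorem6p2 : (p : ℕ) → Prime p → 3 < p → lhs p ≡ rhs p [modP p ^ 2 ]
theorem6p2 p p-prime 3<p with OddPrime.odd-prime p p-prime 3<p
... | h , refl , 2≤h = CoefficientwiseCongruence.congruence h p-prime 2≤h
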